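{- $$\sum_{n\ge0}|\Pi_n(14/23)|\,z^n=G\!\left(\frac{z}{1-z}\right)\frac{1}{1-z}+\frac{1}{1-z},\qquad\text{where}\qquad G(z)=\frac{z-2z^2(1+z)-z\sqrt{1-4z^2}}{ -2+2z(1+z)^2}.$$
   Context: The standardization of a set partition of a finite set $S\subset\mathbb{Z}_{>0}$ replaces the $i$-th smallest element of $S$ by $i$. A set partition $\pi$ of $[n]$ contains $\tau\vdash[k]$ if for some $S\subseteq[n]$ the standardization of the restriction of $\pi$ to $S$ is $\tau$; otherwise it avoids $\tau$. $\Pi_n(\tau)$ is the set of partitions of $[n]$ avoiding $\tau$, with $|\Pi_0(\tau)|=1$ (the empty partition). $14/23$ is the partition of $[4]$ with blocks $\{1,4\},\{2,3\}$. Here $G(z)$ is the generating function $\sum_{n\ge2}|\Pi_n^*(14/23)|z^n$ of $14/23$-avoiding partitions of $[n]$ without singleton blocks. -}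

module Defs where

open import Data.Nat as ℕ using (ℕ; zero; suc; _≤_; _<_; _⊔_)
open import Data.Integer as ℤ using (ℤ; +_; -_)
open import Data.Fin as Fin using (Fin)
open import Data.Vec using (Vec; []; _∷_; lookup)
open import Data.Product using (Σ; ∃; _×_)
open import Data.Unit using (⊤)
open import Relation.Nullary using (¬_)
open import Relation.Binary.PropositionalEquality using (_≡_; _≢_)
open import Function.Definitions using (Injective)

-- Set partitions of [n], encoded canonically as restricted growth
-- strings: block labels 0,1,2,... assigned in order of the least
-- element of each block.  Position i (as Fin n) stands for i+1 ∈ [n].

-- RGS-from m v : v is a valid continuation when labels 0..m-1 are used.
RGS-from : ∀ {n} → ℕ → Vec ℕ n → Set
RGS-from m []       = ⊤
RGS-from m (x ∷ xs) = (x ≤ m) × RGS-from (m ⊔ suc x) xs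

IsSetPartition : ∀ {n} → Vec ℕ n → Set
IsSetPartition v = RGS-from 0 v

SameBlock : ∀ {n} → Vec ℕ n → Fin n → Fin n → Set
SameBlock v i j = lookup v i ≡ lookup v j

Contains : ∀ {n k} → Vec ℕ n → Vec ℕ k → Set
Contains {n} {k} π τ =
  Σ (Fin k → Fin n) λ f →
    (∀ a b → a Fin.< b → f a Fin.< f b) ×
    (∀ a b → (SameBlock π (f a) (f b) → SameBlock τ a b) ×
             (SameBlock τ a b → SameBlock π (f a) (f b)))

Avoids : ∀ {n k} → Vec ℕ n → Vec ℕ k → Set
Avoids π τ = ¬ Contains π τ

-- the pattern 14/23 = {1,4},{2,3}
p14/23 : Vec ℕ 4
p14/23 = 0 ∷ 1 ∷ 1 ∷ 0 ∷ []

NoSingletons : ∀ {n} → Vec ℕ n → Set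
NoSingletons {n} π = ∀ (i : Fin n) → ∃ λ (j : Fin n) → j ≢ i × SameBlock π i j

Π-avoid : (n : ℕ) → Vec ℕ n → Set
Π-avoid n π = IsSetPartition π × Avoids π p14/23

Π*-avoid : (n : ℕ) → Vec ℕ n → Set
Π*-avoid n π = Π-avoid n π × NoSingletons π

-- "exactly c elements of A satisfy P": an injective enumeration
-- Fin c → A whose image is exactly {x | P x}.
HasCount : ∀ {A : Set} → (A → Set) → ℕ → Set
HasCount {A} P c =
  Σ (Fin c → A) λ f →
    Injective _≡_ _≡_ f × (∀ i → P (f i)) × (∀ x → P x → ∃ λ i → f i ≡ x)

-- Formal power series over ℤ: coefficient sequences ℕ → ℤ.

Series : Set
Series = ℕ → ℤ

_≈_ : Series → Series → Set
f ≈ g = ∀ n → f n ≡ g n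

infix 4 _≈_
infixl 6 _⊕_ _⊖_
infixl 7 _⊛_

sumTo : ℕ → (ℕ → ℤ) → ℤ
sumTo zero    f = f 0
sumTo (suc n) f = sumTo n f ℤ.+ f (suc n)

const : ℤ → Series
const c zero    = c
const c (suc n) = + 0

Z : Series
Z 1 = + 1
Z _ = + 0

_⊕_ : Series → Series → Series
(f ⊕ g) n = f n ℤ.+ g n

neg : Series → Series
neg f n = - f n

_⊖_ : Series → Series → Series
f ⊖ g = f ⊕ neg g

_⊛_ : Series → Series → Series
(f ⊛ g) n = sumTo n (λ k → f k ℤ.* g (n ℕ.∸ k))

_^ₛ_ : Series → ℕ → Series
f ^ₛ zero  = const (+ 1)
f ^ₛ suc k = f ⊛ (f ^ₛ k)

-- composition f(h(z)); meaningful when h has zero constant term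
-- (then (h^k)_n = 0 for k > n, so the sum is finite).
_∘ₛ_ : Series → Series → Series
(f ∘ₛ h) n = sumTo n (λ k → f k ℤ.* (h ^ₛ k) n)

-- 1/(1-z) = Σ_{n≥0} z^n  (the unique series g with (1 - z) g = 1)
geom : Series
geom _ = + 1

zOver1-z : Series
zOver1-z = Z ⊛ geom

gfAll : (ℕ → ℕ) → Series
gfAll a n = + a n

gfG : (ℕ → ℕ) → Series
gfG g zero          = + 0
gfG g (suc zero)    = + 0
gfG g (suc (suc n)) = + g (suc (suc n))

-- numerator without the square-root term: z - 2z²(1+z)
numPoly : Series
numPoly = Z ⊖ const (+ 2) ⊛ (Z ^ₛ 2) ⊛ (const (+ 1) ⊕ Z)

denPoly : Series
denPoly = const (- (+ 2)) ⊕ const (+ 2) ⊛ Z ⊛ ((const (+ 1) ⊕ Z) ^ₛ 2)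

radicand : Series
radicand = const (+ 1) ⊖ const (+ 4) ⊛ (Z ^ₛ 2)

-- A set partition of [n] is read as its restricted growth word, and it contains 14/23 exactly when the word has a
-- subsequence a b b a with a ≠ b.  Reading the word from left to right, whether a continuation avoids the pattern
-- depends only on a small state: the current label x₁, whether x₁ must occur again, and the list of earlier labels
-- that must occur again, in the only order in which they can still be read; every other old label is dead.  A new
-- label either opens such a pending block or, when singletons are allowed, is a singleton.  The number of accepted
-- continuations therefore depends only on the shape of the state, and without singletons it satisfies a transfer
-- recursion whose generating functions are powers of the first-passage series B = z (1 + B²) of ±1 paths: the
-- shape with r pending labels contributes H Bʳ with H = 1 + z (H (B + B²) + H), and G = z H B.  Then S = 1 − 2 z B
-- satisfies S² = 1 − 4 z², and eliminating H gives G (−2 + 2 z (1 + z)²) = z − 2 z² (1 + z) − z S.  Singletons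
-- never take part in a pattern, so |Πₙ(14/23)| = Σₖ (n choose k) |Π*ₖ(14/23)|, which is the binomial transform
-- G(z/(1−z))/(1−z) + 1/(1−z) (the last term accounts for the empty partition, excluded from G).

module Submission where

open import Defs
open import Data.Nat as ℕ using (ℕ; zero; suc; _∸_; _⊔_; z≤n; s≤s)
import Data.Nat.Properties as ℕP
open import Data.Nat.Combinatorics using (_C_; nCk+nC[k+1]≡[n+1]C[k+1]; k>n⇒nCk≡0)
open import Data.Nat.Tactic.RingSolver using (solve-∀)
open import Data.Integer as ℤ using (ℤ; +_; -_)
import Data.Integer.Properties as ℤP
open import Algebra.Properties.CommutativeSemigroup ℤP.+-commutativeSemigroup
  using () renaming (interchange to +-interchange)
open import Data.Fin as Fin using (Fin; toℕ; splitAt; _↑ˡ_; _↑ʳ_)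
import Data.Fin.Properties as FinP
open import Data.Vec as V using (Vec; []; _∷_; lookup; toList)
open import Data.List as L using (List; []; _∷_; _++_; _ʳ++_; [_]; length; tabulate)
import Data.List.Properties as LP
open import Data.List.Membership.Propositional using (_∈_; _∉_)
open import Data.List.Membership.Propositional.Properties using (∈-++⁺ˡ; ∈-++⁺ʳ; ∈-++⁻)
open import Data.List.Membership.DecPropositional ℕP._≟_ using (_∈?_)
open import Data.List.Relation.Unary.Any using (here; there)
open import Data.List.Relation.Binary.Sublist.Propositional using (_⊆_; []; _∷_; _∷ʳ_; minimum; to∈; from∈)
open import Data.List.Relation.Binary.Sublist.Propositional.Properties using (∷ˡ⁻; ʳ++⁺; reverse⁺)
open import Data.Bool using (Bool; true; false; if_then_else_)
open import Data.Maybe using (Maybe; just; nothing)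
open import Data.Product using (Σ; ∃; _×_; _,_; proj₁; proj₂)
open import Data.Sum using (_⊎_; inj₁; inj₂; [_,_]′)
open import Data.Unit using (⊤; tt)
open import Data.Empty using (⊥; ⊥-elim)
open import Function using (id; _∘_)
open import Level using (0ℓ)
open import Relation.Nullary using (¬_; yes; no)
open import Relation.Binary.Definitions using (tri<; tri≈; tri>)
open import Relation.Binary.PropositionalEquality hiding ([_])
open import Algebra.Bundles using (CommutativeRing; Ring)
open import Algebra.Solver.Ring.AlmostCommutativeRing
  using (fromCommutativeRing; _-Raw-AlmostCommutative⟶_)
import Algebra.Solver.Ring

open ≡-Reasoning

-- Finite sums and formal power series

sumTo-cong : ∀ n {f g : ℕ → ℤ} → (∀ k → k ℕ.≤ n → f k ≡ g k) → sumTo n f ≡ sumTo n g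
sumTo-cong zero    f≡g = f≡g 0 z≤n
sumTo-cong (suc n) f≡g =
  cong₂ ℤ._+_ (sumTo-cong n (λ k k≤n → f≡g k (ℕP.m≤n⇒m≤1+n k≤n))) (f≡g (suc n) ℕP.≤-refl)

sumTo-zero : ∀ n {f : ℕ → ℤ} → (∀ k → k ℕ.≤ n → f k ≡ + 0) → sumTo n f ≡ + 0
sumTo-zero n f≡0 = trans (sumTo-cong n {g = λ _ → + 0} f≡0) (zeros n)
  where
  zeros : ∀ n → sumTo n (λ _ → + 0) ≡ + 0
  zeros zero    = refl
  zeros (suc n) = cong (ℤ._+ + 0) (zeros n)

sumTo-+ : ∀ n (f g : ℕ → ℤ) → sumTo n (λ k → f k ℤ.+ g k) ≡ sumTo n f ℤ.+ sumTo n g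
sumTo-+ zero    f g = refl
sumTo-+ (suc n) f g = trans (cong (ℤ._+ (f (suc n) ℤ.+ g (suc n))) (sumTo-+ n f g))
                            (+-interchange (sumTo n f) (sumTo n g) (f (suc n)) (g (suc n)))

sumTo-*ˡ : ∀ n c (f : ℕ → ℤ) → sumTo n (λ k → c ℤ.* f k) ≡ c ℤ.* sumTo n f
sumTo-*ˡ zero    c f = refl
sumTo-*ˡ (suc n) c f =
  trans (cong (ℤ._+ c ℤ.* f (suc n)) (sumTo-*ˡ n c f)) (sym (ℤP.*-distribˡ-+ c _ _))

sumTo-*ʳ : ∀ n c (f : ℕ → ℤ) → sumTo n (λ k → f k ℤ.* c) ≡ sumTo n f ℤ.* c
sumTo-*ʳ n c f =
  trans (sumTo-cong n (λ k _ → ℤP.*-comm (f k) c)) (trans (sumTo-*ˡ n c f) (ℤP.*-comm c _))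

sumTo-suc : ∀ n (f : ℕ → ℤ) → sumTo (suc n) f ≡ f 0 ℤ.+ sumTo n (f ∘ suc)
sumTo-suc zero    f = refl
sumTo-suc (suc n) f =
  trans (cong (ℤ._+ f (suc (suc n))) (sumTo-suc n f)) (ℤP.+-assoc (f 0) _ _)

sumTo-reverse : ∀ n (f : ℕ → ℤ) → sumTo n f ≡ sumTo n (λ k → f (n ∸ k))
sumTo-reverse zero    f = refl
sumTo-reverse (suc n) f = begin
  sumTo n f ℤ.+ f (suc n)                     ≡⟨ ℤP.+-comm (sumTo n f) _ ⟩
  f (suc n) ℤ.+ sumTo n f                     ≡⟨ cong (λ t → f (suc n) ℤ.+ t) (sumTo-reverse n f) ⟩
  f (suc n) ℤ.+ sumTo n (λ k → f (n ∸ k))     ≡⟨ sumTo-suc n (λ k → f (suc n ∸ k)) ⟨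
  sumTo (suc n) (λ k → f (suc n ∸ k))         ∎

sumTo-swap-triangle : ∀ n (a : ℕ → ℕ → ℤ) →
  sumTo n (λ i → sumTo (n ∸ i) (a i)) ≡ sumTo n (λ m → sumTo m (λ i → a i (m ∸ i)))
sumTo-swap-triangle zero    a = refl
sumTo-swap-triangle (suc n) a = begin
  sumTo (suc n) (λ i → sumTo (suc n ∸ i) (a i))
    ≡⟨ cong₂ ℤ._+_ (sumTo-cong n (λ i i≤n → cong (λ t → sumTo t (a i)) (ℕP.+-∸-assoc 1 i≤n)))
                   (cong (λ t → sumTo t (a (suc n))) (ℕP.n∸n≡0 n)) ⟩
  sumTo n (λ i → sumTo (n ∸ i) (a i) ℤ.+ a i (suc (n ∸ i))) ℤ.+ a (suc n) 0
    ≡⟨ cong (ℤ._+ a (suc n) 0) (sumTo-+ n _ _) ⟩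
  (sumTo n (λ i → sumTo (n ∸ i) (a i)) ℤ.+ sumTo n (λ i → a i (suc (n ∸ i)))) ℤ.+ a (suc n) 0
    ≡⟨ ℤP.+-assoc (sumTo n (λ i → sumTo (n ∸ i) (a i))) _ _ ⟩
  sumTo n (λ i → sumTo (n ∸ i) (a i)) ℤ.+ (sumTo n (λ i → a i (suc (n ∸ i))) ℤ.+ a (suc n) 0)
    ≡⟨ cong₂ ℤ._+_ (sumTo-swap-triangle n a)
         (cong₂ ℤ._+_ (sumTo-cong n (λ i i≤n → cong (a i) (sym (ℕP.+-∸-assoc 1 i≤n))))
                      (cong (a (suc n)) (sym (ℕP.n∸n≡0 n)))) ⟩
  sumTo (suc n) (λ m → sumTo m (λ i → a i (m ∸ i))) ∎

sumTo-swap-square : ∀ n p (a : ℕ → ℕ → ℤ) →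
  sumTo n (λ i → sumTo p (a i)) ≡ sumTo p (λ j → sumTo n (λ i → a i j))
sumTo-swap-square zero    p a = refl
sumTo-swap-square (suc n) p a =
  trans (cong (ℤ._+ sumTo p (a (suc n))) (sumTo-swap-square n p a))
        (sym (sumTo-+ p (λ j → sumTo n (λ i → a i j)) (a (suc n))))

sumTo-extend : ∀ m d (f : ℕ → ℤ) → (∀ k → m ℕ.< k → f k ≡ + 0) → sumTo m f ≡ sumTo (m ℕ.+ d) f
sumTo-extend m zero    f vanish = cong (λ t → sumTo t f) (sym (ℕP.+-identityʳ m))
sumTo-extend m (suc d) f vanish = begin
  sumTo m f                                   ≡⟨ sumTo-extend m d f vanish ⟩
  sumTo (m ℕ.+ d) f                           ≡⟨ ℤP.+-identityʳ _ ⟨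
  sumTo (m ℕ.+ d) f ℤ.+ + 0                   ≡⟨ cong (λ t → sumTo (m ℕ.+ d) f ℤ.+ t) (vanish _ (s≤s (ℕP.m≤m+n m d))) ⟨
  sumTo (suc (m ℕ.+ d)) f                     ≡⟨ cong (λ t → sumTo t f) (ℕP.+-suc m d) ⟨
  sumTo (m ℕ.+ suc d) f                       ∎

≈-refl : ∀ {f : Series} → f ≈ f
≈-refl n = refl

≈-sym : ∀ {f g : Series} → f ≈ g → g ≈ f
≈-sym f≈g n = sym (f≈g n)

≈-trans : ∀ {f g h : Series} → f ≈ g → g ≈ h → f ≈ h
≈-trans f≈g g≈h n = trans (f≈g n) (g≈h n)

⊕-cong : ∀ {f f' g g' : Series} → f ≈ f' → g ≈ g' → f ⊕ g ≈ f' ⊕ g'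
⊕-cong f≈f' g≈g' n = cong₂ ℤ._+_ (f≈f' n) (g≈g' n)

neg-cong : ∀ {f f' : Series} → f ≈ f' → neg f ≈ neg f'
neg-cong f≈f' n = cong -_ (f≈f' n)

⊛-cong : ∀ {f f' g g' : Series} → f ≈ f' → g ≈ g' → f ⊛ g ≈ f' ⊛ g'
⊛-cong f≈f' g≈g' n = sumTo-cong n (λ k _ → cong₂ ℤ._*_ (f≈f' k) (g≈g' (n ∸ k)))

⊛-comm : ∀ (f g : Series) → f ⊛ g ≈ g ⊛ f
⊛-comm f g n = begin
  sumTo n (λ k → f k ℤ.* g (n ∸ k))                  ≡⟨ sumTo-reverse n _ ⟩
  sumTo n (λ k → f (n ∸ k) ℤ.* g (n ∸ (n ∸ k)))      ≡⟨ sumTo-cong n flip ⟩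
  sumTo n (λ k → g k ℤ.* f (n ∸ k))                  ∎
  where
  flip : ∀ k → k ℕ.≤ n → f (n ∸ k) ℤ.* g (n ∸ (n ∸ k)) ≡ g k ℤ.* f (n ∸ k)
  flip k k≤n = trans (cong (λ t → f (n ∸ k) ℤ.* g t) (ℕP.m∸[m∸n]≡n k≤n)) (ℤP.*-comm (f (n ∸ k)) (g k))

⊛-assoc : ∀ (f g h : Series) → (f ⊛ g) ⊛ h ≈ f ⊛ (g ⊛ h)
⊛-assoc f g h n = sym (begin
  sumTo n (λ i → f i ℤ.* sumTo (n ∸ i) (λ j → g j ℤ.* h (n ∸ i ∸ j)))
    ≡⟨ sumTo-cong n (λ i _ → sym (sumTo-*ˡ (n ∸ i) (f i) _)) ⟩
  sumTo n (λ i → sumTo (n ∸ i) (λ j → f i ℤ.* (g j ℤ.* h (n ∸ i ∸ j))))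
    ≡⟨ sumTo-swap-triangle n (λ i j → f i ℤ.* (g j ℤ.* h (n ∸ i ∸ j))) ⟩
  sumTo n (λ m → sumTo m (λ i → f i ℤ.* (g (m ∸ i) ℤ.* h (n ∸ i ∸ (m ∸ i)))))
    ≡⟨ sumTo-cong n (λ m m≤n → sumTo-cong m (λ i i≤m → regroup m i i≤m)) ⟩
  sumTo n (λ m → sumTo m (λ i → f i ℤ.* g (m ∸ i) ℤ.* h (n ∸ m)))
    ≡⟨ sumTo-cong n (λ m _ → sumTo-*ʳ m (h (n ∸ m)) _) ⟩
  sumTo n (λ m → sumTo m (λ i → f i ℤ.* g (m ∸ i)) ℤ.* h (n ∸ m)) ∎)
  where
  regroup : ∀ m i → i ℕ.≤ m →
    f i ℤ.* (g (m ∸ i) ℤ.* h (n ∸ i ∸ (m ∸ i))) ≡ f i ℤ.* g (m ∸ i) ℤ.* h (n ∸ m)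
  regroup m i i≤m = begin
    f i ℤ.* (g (m ∸ i) ℤ.* h (n ∸ i ∸ (m ∸ i)))
      ≡⟨ cong (λ t → f i ℤ.* (g (m ∸ i) ℤ.* h t)) (ℕP.∸-+-assoc n i (m ∸ i)) ⟩
    f i ℤ.* (g (m ∸ i) ℤ.* h (n ∸ (i ℕ.+ (m ∸ i))))
      ≡⟨ cong (λ t → f i ℤ.* (g (m ∸ i) ℤ.* h (n ∸ t))) (ℕP.m+[n∸m]≡n i≤m) ⟩
    f i ℤ.* (g (m ∸ i) ℤ.* h (n ∸ m))
      ≡⟨ ℤP.*-assoc (f i) (g (m ∸ i)) (h (n ∸ m)) ⟨
    f i ℤ.* g (m ∸ i) ℤ.* h (n ∸ m) ∎

⊛-distribˡ-⊕ : ∀ (f g h : Series) → f ⊛ (g ⊕ h) ≈ f ⊛ g ⊕ f ⊛ h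
⊛-distribˡ-⊕ f g h n =
  trans (sumTo-cong n (λ k _ → ℤP.*-distribˡ-+ (f k) (g (n ∸ k)) (h (n ∸ k)))) (sumTo-+ n _ _)

⊛-distribʳ-⊕ : ∀ (f g h : Series) → (g ⊕ h) ⊛ f ≈ g ⊛ f ⊕ h ⊛ f
⊛-distribʳ-⊕ f g h =
  ≈-trans (⊛-comm (g ⊕ h) f) (≈-trans (⊛-distribˡ-⊕ f g h) (⊕-cong (⊛-comm f g) (⊛-comm f h)))

const⊛ : ∀ c (f : Series) → const c ⊛ f ≈ (λ n → c ℤ.* f n)
const⊛ c f zero    = refl
const⊛ c f (suc n) = begin
  sumTo (suc n) (λ k → const c k ℤ.* f (suc n ∸ k))          ≡⟨ sumTo-suc n _ ⟩
  c ℤ.* f (suc n) ℤ.+ sumTo n (λ k → + 0 ℤ.* f (n ∸ k))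
    ≡⟨ cong (λ t → c ℤ.* f (suc n) ℤ.+ t) (sumTo-zero n (λ _ _ → refl)) ⟩
  c ℤ.* f (suc n) ℤ.+ + 0                                     ≡⟨ ℤP.+-identityʳ _ ⟩
  c ℤ.* f (suc n)                                             ∎

⊛-identityˡ : ∀ (f : Series) → const (+ 1) ⊛ f ≈ f
⊛-identityˡ f n = trans (const⊛ (+ 1) f n) (ℤP.*-identityˡ (f n))

⊛-identityʳ : ∀ (f : Series) → f ⊛ const (+ 1) ≈ f
⊛-identityʳ f = ≈-trans (⊛-comm f (const (+ 1))) (⊛-identityˡ f)

Z⊛-suc : ∀ (f : Series) n → (Z ⊛ f) (suc n) ≡ f n
Z⊛-suc f n = begin
  sumTo (suc n) (λ k → Z k ℤ.* f (suc n ∸ k))        ≡⟨ sumTo-suc n _ ⟩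
  + 0 ℤ.+ sumTo n (λ k → Z (suc k) ℤ.* f (n ∸ k))    ≡⟨ ℤP.+-identityˡ _ ⟩
  sumTo n (λ k → Z (suc k) ℤ.* f (n ∸ k))            ≡⟨ only-first n ⟩
  f n                                                ∎
  where
  only-first : ∀ m → sumTo m (λ k → Z (suc k) ℤ.* f (n ∸ k)) ≡ f n
  only-first zero    = ℤP.*-identityˡ (f n)
  only-first (suc m) = trans (cong (ℤ._+ + 0) (only-first m)) (ℤP.+-identityʳ (f n))

≈Z⊛ : ∀ {f g : Series} → f 0 ≡ + 0 → (∀ n → f (suc n) ≡ g n) → f ≈ Z ⊛ g
≈Z⊛ f0 fs zero    = f0
≈Z⊛ {g = g} f0 fs (suc n) = trans (fs n) (sym (Z⊛-suc g n))

seriesCommutativeRing : CommutativeRing 0ℓ 0ℓ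
seriesCommutativeRing = record
  { Carrier = Series ; _≈_ = _≈_ ; _+_ = _⊕_ ; _*_ = _⊛_ ; -_ = neg
  ; 0# = const (+ 0) ; 1# = const (+ 1)
  ; isCommutativeRing = record
    { isRing = record
      { +-isAbelianGroup = record
        { isGroup = record
          { isMonoid = record
            { isSemigroup = record
              { isMagma = record
                { isEquivalence = record { refl = ≈-refl ; sym = ≈-sym ; trans = ≈-trans }
                ; ∙-cong = ⊕-cong }
              ; assoc = λ f g h n → ℤP.+-assoc (f n) (g n) (h n) }
            ; identity = at (λ x o → o ℤ.+ x ≡ x) ℤP.+-identityˡ
                       , at (λ x o → x ℤ.+ o ≡ x) ℤP.+-identityʳ }
          ; inverse = at (λ x o → - x ℤ.+ x ≡ o) ℤP.+-inverseˡ
                    , at (λ x o → x ℤ.+ - x ≡ o) ℤP.+-inverseʳ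
          ; ⁻¹-cong = neg-cong }
        ; comm = λ f g n → ℤP.+-comm (f n) (g n) }
      ; *-cong = ⊛-cong
      ; *-assoc = ⊛-assoc
      ; *-identity = ⊛-identityˡ , ⊛-identityʳ
      ; distrib = ⊛-distribˡ-⊕ , ⊛-distribʳ-⊕ }
    ; *-comm = ⊛-comm } }
  where
  -- const (+ 0) n only reduces to + 0 once n is split
  at : ∀ (P : ℤ → ℤ → Set) → (∀ x → P x (+ 0)) → ∀ (f : Series) n → P (f n) (const (+ 0) n)
  at P law f zero    = law (f zero)
  at P law f (suc n) = law (f (suc n))

const-+ : ∀ c d → const (c ℤ.+ d) ≈ const c ⊕ const d
const-+ c d zero    = refl
const-+ c d (suc n) = refl

const-* : ∀ c d → const (c ℤ.* d) ≈ const c ⊛ const d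
const-* c d zero    = refl
const-* c d (suc n) = sym (trans (const⊛ c (const d) (suc n)) (ℤP.*-zeroʳ c))

const-neg : ∀ c → const (- c) ≈ neg (const c)
const-neg c zero    = refl
const-neg c (suc n) = refl

const-homomorphism : Ring.rawRing ℤP.+-*-ring -Raw-AlmostCommutative⟶ fromCommutativeRing seriesCommutativeRing
const-homomorphism = record
  { ⟦_⟧ = const ; +-homo = const-+ ; *-homo = const-* ; -‿homo = const-neg
  ; 0-homo = ≈-refl ; 1-homo = ≈-refl }

const-≟ : ∀ c d → Maybe (const c ≈ const d)
const-≟ c d with c ℤ.≟ d
... | yes refl = just ≈-refl
... | no _     = nothing

module SeriesSolver = Algebra.Solver.Ring
  (Ring.rawRing ℤP.+-*-ring) (fromCommutativeRing seriesCommutativeRing) const-homomorphism const-≟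

⊛geom : ∀ (f : Series) n → (f ⊛ geom) n ≡ sumTo n f
⊛geom f n = sumTo-cong n (λ k _ → ℤP.*-identityʳ (f k))

zOver1-z^-vanishes : ∀ k m → m ℕ.< k → (zOver1-z ^ₛ k) m ≡ + 0
zOver1-z^-vanishes (suc k) m (s≤s m≤k) = sumTo-zero m term
  where
  term : ∀ i → i ℕ.≤ m → zOver1-z i ℤ.* (zOver1-z ^ₛ k) (m ∸ i) ≡ + 0
  term zero    _   = refl
  term (suc i) i<m = trans (cong (zOver1-z (suc i) ℤ.*_)
                                 (zOver1-z^-vanishes k (m ∸ suc i) (ℕP.<-≤-trans (ℕP.∸-monoʳ-< {m} (s≤s z≤n) i<m) m≤k)))
                           (ℤP.*-zeroʳ (zOver1-z (suc i)))

zOver1-z^-suc : ∀ k m → (zOver1-z ^ₛ suc k) (suc m) ≡ sumTo m (zOver1-z ^ₛ k)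
zOver1-z^-suc k m = begin
  ((Z ⊛ geom) ⊛ (zOver1-z ^ₛ k)) (suc m)      ≡⟨ ⊛-assoc Z geom (zOver1-z ^ₛ k) (suc m) ⟩
  (Z ⊛ (geom ⊛ (zOver1-z ^ₛ k))) (suc m)      ≡⟨ Z⊛-suc (geom ⊛ (zOver1-z ^ₛ k)) m ⟩
  (geom ⊛ (zOver1-z ^ₛ k)) m                  ≡⟨ ⊛-comm geom (zOver1-z ^ₛ k) m ⟩
  ((zOver1-z ^ₛ k) ⊛ geom) m                  ≡⟨ ⊛geom (zOver1-z ^ₛ k) m ⟩
  sumTo m (zOver1-z ^ₛ k)                     ∎

sumTo-zOver1-z^ : ∀ k n → sumTo n (zOver1-z ^ₛ k) ≡ + (n C k)
sumTo-zOver1-z^ zero    zero    = refl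
sumTo-zOver1-z^ zero    (suc n) = cong (ℤ._+ + 0) (sumTo-zOver1-z^ zero n)
sumTo-zOver1-z^ (suc k) zero    = zOver1-z^-vanishes (suc k) 0 (s≤s z≤n)
sumTo-zOver1-z^ (suc k) (suc n) = begin
  sumTo n (zOver1-z ^ₛ suc k) ℤ.+ (zOver1-z ^ₛ suc k) (suc n)
    ≡⟨ cong₂ ℤ._+_ (sumTo-zOver1-z^ (suc k) n) (trans (zOver1-z^-suc k n) (sumTo-zOver1-z^ k n)) ⟩
  + (n C suc k) ℤ.+ + (n C k)        ≡⟨ ℤP.pos-+ (n C suc k) _ ⟨
  + (n C suc k ℕ.+ n C k)            ≡⟨ cong +_ (ℕP.+-comm (n C suc k) _) ⟩
  + (n C k ℕ.+ n C suc k)            ≡⟨ cong +_ (nCk+nC[k+1]≡[n+1]C[k+1] n k) ⟩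
  + (suc n C suc k)                  ∎

binomial-transform : ∀ (f : Series) n → ((f ∘ₛ zOver1-z) ⊛ geom) n ≡ sumTo n (λ k → f k ℤ.* + (n C k))
binomial-transform f n = begin
  ((f ∘ₛ zOver1-z) ⊛ geom) n
    ≡⟨ ⊛geom (f ∘ₛ zOver1-z) n ⟩
  sumTo n (λ m → sumTo m (λ k → f k ℤ.* (zOver1-z ^ₛ k) m))
    ≡⟨ sumTo-cong n (λ m m≤n → trans (sumTo-extend m (n ∸ m) _ (vanish m))
                                     (cong (λ t → sumTo t (λ k → f k ℤ.* (zOver1-z ^ₛ k) m)) (ℕP.m+[n∸m]≡n m≤n))) ⟩
  sumTo n (λ m → sumTo n (λ k → f k ℤ.* (zOver1-z ^ₛ k) m))
    ≡⟨ sumTo-swap-square n n (λ m k → f k ℤ.* (zOver1-z ^ₛ k) m) ⟩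
  sumTo n (λ k → sumTo n (λ m → f k ℤ.* (zOver1-z ^ₛ k) m))
    ≡⟨ sumTo-cong n (λ k _ → trans (sumTo-*ˡ n (f k) _) (cong (f k ℤ.*_) (sumTo-zOver1-z^ k n))) ⟩
  sumTo n (λ k → f k ℤ.* + (n C k)) ∎
  where
  vanish : ∀ m k → m ℕ.< k → f k ℤ.* (zOver1-z ^ₛ k) m ≡ + 0
  vanish m k m<k = trans (cong (f k ℤ.*_) (zOver1-z^-vanishes k m m<k)) (ℤP.*-zeroʳ (f k))

-- Pattern-avoiding words and the automaton reading them

Pattern : ℕ → ℕ → List ℕ
Pattern a b = a ∷ b ∷ b ∷ a ∷ []

PatternFree : List ℕ → Set
PatternFree w = ∀ a b → a ≢ b → ¬ (Pattern a b ⊆ w)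

Twice : ℕ → List ℕ → Set
Twice z w = z ∷ z ∷ [] ⊆ w

⊆-∷⁻ : ∀ {a x : ℕ} {as r} → a ∷ as ⊆ x ∷ r → a ∷ as ⊆ r ⊎ (a ≡ x × as ⊆ r)
⊆-∷⁻ (_ ∷ʳ p) = inj₁ p
⊆-∷⁻ (e ∷ p)  = inj₂ (e , p)

second∈ : ∀ {a b : ℕ} {r} → a ∷ b ∷ [] ⊆ r → b ∈ r
second∈ p = to∈ (∷ˡ⁻ p)

third∈ : ∀ {a b c : ℕ} {r} → a ∷ b ∷ c ∷ [] ⊆ r → c ∈ r
third∈ p = to∈ (∷ˡ⁻ (∷ˡ⁻ p))

∉⇒≢ : ∀ {x y : ℕ} {r} → x ∉ r → y ∈ r → x ≢ y
∉⇒≢ x∉r y∈r refl = x∉r y∈r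

-- Throughout, r is the word read so far in reverse: a ∷ b ∷ [] ⊆ r says that some b is read before some a.
pattern-closes : ∀ {a b : ℕ} {r v} → b ∷ a ∷ [] ⊆ r → a ∈ v → Pattern a b ⊆ r ʳ++ (b ∷ v)
pattern-closes ba⊆r a∈v = ʳ++⁺ ba⊆r (refl ∷ from∈ a∈v)

-- Pattern a b is a palindrome.
PatternFree-reverse : ∀ {r} → PatternFree r → PatternFree (r ʳ++ [])
PatternFree-reverse {r} free a b a≢b p =
  free a b a≢b (subst (Pattern a b ⊆_) (LP.reverse-involutive r) (reverse⁺ p))

¬⊆-∷ : ∀ {r} {a ℓ x : ℕ} → ¬ (a ∷ ℓ ∷ [] ⊆ r) → a ≢ x → ¬ (a ∷ ℓ ∷ [] ⊆ x ∷ r)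
¬⊆-∷ aℓ⊈r a≢x p with ⊆-∷⁻ p
... | inj₁ p′         = aℓ⊈r p′
... | inj₂ (a≡x , _) = a≢x a≡x

¬⊆-fresh : ∀ {r} {a x : ℕ} → x ∉ r → ¬ (a ∷ x ∷ [] ⊆ x ∷ r)
¬⊆-fresh x∉r p with ⊆-∷⁻ p
... | inj₁ p′       = x∉r (second∈ p′)
... | inj₂ (_ , p′) = x∉r (to∈ p′)

CanRecur : List ℕ → ℕ → Set
CanRecur r ℓ = ∀ y → y ≢ ℓ → ¬ (y ∷ y ∷ ℓ ∷ [] ⊆ r)

CanRecur-∷ : ∀ {r} {ℓ x : ℕ} → CanRecur r ℓ → ¬ (x ∷ ℓ ∷ [] ⊆ r) → CanRecur (x ∷ r) ℓ
CanRecur-∷ ok xℓ⊈r y y≢ℓ p with ⊆-∷⁻ p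
... | inj₁ p′          = ok y y≢ℓ p′
... | inj₂ (refl , p′) = xℓ⊈r p′

CanRecur-self : ∀ {r} {x : ℕ} → CanRecur r x → CanRecur (x ∷ r) x
CanRecur-self ok y y≢x p with ⊆-∷⁻ p
... | inj₁ p′        = ok y y≢x p′
... | inj₂ (y≡x , _) = y≢x y≡x

CanRecur-fresh : ∀ {r} {x : ℕ} → x ∉ r → CanRecur (x ∷ r) x
CanRecur-fresh x∉r y y≢x p with ⊆-∷⁻ p
... | inj₁ p′       = x∉r (third∈ p′)
... | inj₂ (_ , p′) = x∉r (second∈ p′)

PatternFree-∷ : ∀ {r} {x : ℕ} → PatternFree r → x ∉ r ⊎ CanRecur r x → PatternFree (x ∷ r)
PatternFree-∷ free x-ok a b a≢b p with ⊆-∷⁻ p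
... | inj₁ p′ = free a b a≢b p′
... | inj₂ (refl , p′) with x-ok
...   | inj₁ x∉r = x∉r (third∈ p′)
...   | inj₂ ok  = ok b (λ b≡a → a≢b (sym b≡a)) p′

Ordered : List ℕ → List ℕ → Set
Ordered r []      = ⊤
Ordered r (ℓ ∷ L) =
  (∀ ℓ′ → ℓ′ ∈ L → ℓ′ ≢ ℓ × ℓ′ ∷ ℓ ∷ [] ⊆ r × ¬ (ℓ ∷ ℓ′ ∷ [] ⊆ r)) × Ordered r L

Ordered-∷ : ∀ {r} {x : ℕ} L → Ordered r L → (∀ ℓ → ℓ ∈ L → x ≢ ℓ) → Ordered (x ∷ r) L
Ordered-∷ []      _          _     = tt
Ordered-∷ (ℓ ∷ L) (ord , ords) x≢L =
  (λ ℓ′ m → let (ℓ′≢ℓ , ℓ′ℓ⊆r , ℓℓ′⊈r) = ord ℓ′ m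
            in ℓ′≢ℓ , _ ∷ʳ ℓ′ℓ⊆r , ¬⊆-∷ ℓℓ′⊈r (λ ℓ≡x → x≢L ℓ (here refl) (sym ℓ≡x)))
  , Ordered-∷ L ords (λ ℓ′ m → x≢L ℓ′ (there m))

Ordered-snoc : ∀ {r} {x : ℕ} L → Ordered r L → x ∉ r → (∀ ℓ → ℓ ∈ L → ℓ ∈ r) → Ordered (x ∷ r) (L ++ [ x ])
Ordered-snoc []      _          _   _    = (λ _ ()) , tt
Ordered-snoc {r} {x} (ℓ ∷ L) (ord , ords) x∉r L⊆r = later , Ordered-snoc L ords x∉r (λ ℓ′ m → L⊆r ℓ′ (there m))
  where
  ℓ∈r : ℓ ∈ r
  ℓ∈r = L⊆r ℓ (here refl)
  later : ∀ ℓ′ → ℓ′ ∈ L ++ [ x ] →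
    ℓ′ ≢ ℓ × ℓ′ ∷ ℓ ∷ [] ⊆ x ∷ r × ¬ (ℓ ∷ ℓ′ ∷ [] ⊆ x ∷ r)
  later ℓ′ m with ∈-++⁻ L m
  ... | inj₁ m′ = let (ℓ′≢ℓ , ℓ′ℓ⊆r , ℓℓ′⊈r) = ord ℓ′ m′
                  in ℓ′≢ℓ , _ ∷ʳ ℓ′ℓ⊆r , ¬⊆-∷ ℓℓ′⊈r (λ ℓ≡x → ∉⇒≢ x∉r ℓ∈r (sym ℓ≡x))
  ... | inj₂ (here refl) = ∉⇒≢ x∉r ℓ∈r , refl ∷ from∈ ℓ∈r , ¬⊆-fresh x∉r

-- tracking x₁ P Q s: x₁ is the current label, P ++ Q are the labels that must still occur, in the order in which
-- they have to occur (those in P occurred before the last x₁), and s says whether x₁ must occur again.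
data Core : Set where
  none     : Core
  tracking : ℕ → List ℕ → List ℕ → Bool → Core

record State : Set where
  constructor state
  field
    seen : List ℕ
    core : Core
open State public

data Step : Bool → State → ℕ → State → Set where
  singleton : ∀ {seen c x} → x ∉ seen → Step true (state seen c) x (state (x ∷ seen) c)
  first     : ∀ {singles seen x} → x ∉ seen →
              Step singles (state seen none) x (state (x ∷ seen) (tracking x [] [] true))
  fresh     : ∀ {singles seen x x₁ P Q s} → x ∉ seen →
              Step singles (state seen (tracking x₁ P Q s)) x (state (x ∷ seen) (tracking x₁ P (Q ++ [ x ]) s))
  again     : ∀ {singles seen x₁ Q s} →
              Step singles (state seen (tracking x₁ [] Q s)) x₁ (state seen (tracking x₁ Q [] false))
  next      : ∀ {singles seen x₁ P Q y R} → P ++ Q ≡ y ∷ R →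
              Step singles (state seen (tracking x₁ P Q false)) y (state seen (tracking y R [] false))

Accepting : Core → Set
Accepting none                      = ⊤
Accepting (tracking _ [] [] false)  = ⊤
Accepting (tracking _ [] [] true)   = ⊥
Accepting (tracking _ [] (_ ∷ _) _) = ⊥
Accepting (tracking _ (_ ∷ _) _ _)  = ⊥

Run : Bool → State → List ℕ → Set
Run singles σ []      = Accepting (core σ)
Run singles σ (x ∷ v) = Σ State (λ σ′ → Step singles σ x σ′ × Run singles σ′ v)

record TrackingInv (r : List ℕ) (x₁ : ℕ) (P Q : List ℕ) : Set where
  field
    current∈          : x₁ ∈ r
    current-recurs    : CanRecur r x₁
    pending∈          : ∀ {ℓ} → ℓ ∈ P ++ Q → ℓ ∈ r
    pending-recurs    : ∀ {ℓ} → ℓ ∈ P ++ Q → CanRecur r ℓ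
    pending≢current   : ∀ {ℓ} → ℓ ∈ P ++ Q → ℓ ≢ x₁
    current-before    : ∀ {ℓ} → ℓ ∈ P ++ Q → ℓ ∷ x₁ ∷ [] ⊆ r
    P-before-current  : ∀ {ℓ} → ℓ ∈ P → x₁ ∷ ℓ ∷ [] ⊆ r
    Q-after-current   : ∀ {ℓ} → ℓ ∈ Q → ¬ (x₁ ∷ ℓ ∷ [] ⊆ r)
    ordered           : Ordered r (P ++ Q)
open TrackingInv

∈-++-[]⁻ : ∀ {ℓ : ℕ} L → ℓ ∈ L ++ [] → ℓ ∈ L
∈-++-[]⁻ L = subst (_ ∈_) (LP.++-identityʳ L)

∈-snoc⁻ : ∀ {ℓ x : ℕ} L → ℓ ∈ L ++ [ x ] → ℓ ∈ L ⊎ ℓ ≡ x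
∈-snoc⁻ L m with ∈-++⁻ L m
... | inj₁ m′        = inj₁ m′
... | inj₂ (here e) = inj₂ e

∈-++-snoc⁻ : ∀ {ℓ x : ℕ} P Q → ℓ ∈ P ++ (Q ++ [ x ]) → ℓ ∈ P ++ Q ⊎ ℓ ≡ x
∈-++-snoc⁻ P Q m = ∈-snoc⁻ (P ++ Q) (subst (_ ∈_) (sym (LP.++-assoc P Q _)) m)

TrackingInv-∷ : ∀ {r x x₁ P Q} → x ∉ r → TrackingInv r x₁ P Q → TrackingInv (x ∷ r) x₁ P Q
TrackingInv-∷ {r} {x} {x₁} {P} {Q} x∉r I = record
  { current∈         = there (current∈ I)
  ; current-recurs   = CanRecur-∷ (current-recurs I) (λ p → x∉r (to∈ p))
  ; pending∈         = λ m → there (pending∈ I m)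
  ; pending-recurs   = λ m → CanRecur-∷ (pending-recurs I m) (λ p → x∉r (to∈ p))
  ; pending≢current  = pending≢current I
  ; current-before   = λ m → x ∷ʳ current-before I m
  ; P-before-current = λ m → x ∷ʳ P-before-current I m
  ; Q-after-current  = λ m → ¬⊆-∷ (Q-after-current I m) (λ x₁≡x → ∉⇒≢ x∉r (current∈ I) (sym x₁≡x))
  ; ordered          = Ordered-∷ (P ++ Q) (ordered I) (λ ℓ m → ∉⇒≢ x∉r (pending∈ I m))
  }

TrackingInv-fresh : ∀ {r x x₁ P Q} → x ∉ r → TrackingInv r x₁ P Q → TrackingInv (x ∷ r) x₁ P (Q ++ [ x ])
TrackingInv-fresh {r} {x} {x₁} {P} {Q} x∉r I = record
  { current∈         = current∈ I′
  ; current-recurs   = current-recurs I′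
  ; pending∈         = λ m → [ pending∈ I′ , (λ { refl → here refl }) ]′ (∈-++-snoc⁻ P Q m)
  ; pending-recurs   = λ m → [ pending-recurs I′ , (λ { refl → CanRecur-fresh x∉r }) ]′ (∈-++-snoc⁻ P Q m)
  ; pending≢current  = λ m → [ pending≢current I′ , (λ { refl → ∉⇒≢ x∉r (current∈ I) }) ]′ (∈-++-snoc⁻ P Q m)
  ; current-before   = λ m → [ current-before I′ , (λ { refl → refl ∷ from∈ (current∈ I) }) ]′ (∈-++-snoc⁻ P Q m)
  ; P-before-current = P-before-current I′
  ; Q-after-current  = λ m → [ Q-after-current I′ , (λ { refl → ¬⊆-fresh x∉r }) ]′ (∈-snoc⁻ Q m)
  ; ordered          = subst (Ordered (x ∷ r)) (LP.++-assoc P Q [ x ])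
                             (Ordered-snoc (P ++ Q) (ordered I) x∉r (λ ℓ → pending∈ I))
  }
  where
  I′ = TrackingInv-∷ x∉r I

TrackingInv-first : ∀ {r x} → x ∉ r → TrackingInv (x ∷ r) x [] []
TrackingInv-first x∉r = record
  { current∈ = here refl ; current-recurs = CanRecur-fresh x∉r
  ; pending∈ = λ () ; pending-recurs = λ () ; pending≢current = λ () ; current-before = λ ()
  ; P-before-current = λ () ; Q-after-current = λ () ; ordered = tt }

TrackingInv-again : ∀ {r x₁ Q} → TrackingInv r x₁ [] Q → TrackingInv (x₁ ∷ r) x₁ Q []
TrackingInv-again {r} {x₁} {Q} I = record
  { current∈         = here refl
  ; current-recurs   = CanRecur-self (current-recurs I)
  ; pending∈         = λ m → there (pending∈ I (∈-++-[]⁻ Q m))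
  ; pending-recurs   = λ m → CanRecur-∷ (pending-recurs I (∈-++-[]⁻ Q m)) (Q-after-current I (∈-++-[]⁻ Q m))
  ; pending≢current  = λ m → pending≢current I (∈-++-[]⁻ Q m)
  ; current-before   = λ m → x₁ ∷ʳ current-before I (∈-++-[]⁻ Q m)
  ; P-before-current = λ m → refl ∷ from∈ (pending∈ I m)
  ; Q-after-current  = λ ()
  ; ordered          = subst (Ordered (x₁ ∷ r)) (sym (LP.++-identityʳ Q))
                             (Ordered-∷ Q (ordered I) (λ ℓ m x₁≡ℓ → pending≢current I m (sym x₁≡ℓ)))
  }

TrackingInv-next : ∀ {r x₁ P Q y R} → P ++ Q ≡ y ∷ R → TrackingInv r x₁ P Q → TrackingInv (y ∷ r) y R []
TrackingInv-next {r} {x₁} {P} {Q} {y} {R} PQ≡yR I = record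
  { current∈         = here refl
  ; current-recurs   = CanRecur-self (pending-recurs I (in-PQ (here refl)))
  ; pending∈         = λ m → there (pending∈ I (in-PQ (there (∈-++-[]⁻ R m))))
  ; pending-recurs   = λ m → CanRecur-∷ (pending-recurs I (in-PQ (there (∈-++-[]⁻ R m))))
                                        (proj₂ (proj₂ (y-first _ (∈-++-[]⁻ R m))))
  ; pending≢current  = λ m → proj₁ (y-first _ (∈-++-[]⁻ R m))
  ; current-before   = λ m → y ∷ʳ proj₁ (proj₂ (y-first _ (∈-++-[]⁻ R m)))
  ; P-before-current = λ m → refl ∷ from∈ (pending∈ I (in-PQ (there m)))
  ; Q-after-current  = λ ()
  ; ordered          = subst (Ordered (y ∷ r)) (sym (LP.++-identityʳ R))
                             (Ordered-∷ R (proj₂ ord) (λ ℓ m y≡ℓ → proj₁ (y-first ℓ m) (sym y≡ℓ)))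
  }
  where
  in-PQ : ∀ {ℓ} → ℓ ∈ y ∷ R → ℓ ∈ P ++ Q
  in-PQ = subst (_ ∈_) (sym PQ≡yR)
  ord : Ordered r (y ∷ R)
  ord = subst (Ordered r) PQ≡yR (ordered I)
  y-first = proj₁ ord

CoreInv : List ℕ → Core → Set
CoreInv r none                 = ⊤
CoreInv r (tracking x₁ P Q _) = TrackingInv r x₁ P Q

record Inv (r : List ℕ) (σ : State) : Set where
  field
    seen⇒read : ∀ {z} → z ∈ seen σ → z ∈ r
    read⇒seen : ∀ {z} → z ∈ r → z ∈ seen σ
    free      : PatternFree r
    core-inv  : CoreInv r (core σ)
open Inv

Inv-new : ∀ {r seen c c′ x} → Inv r (state seen c) → x ∉ seen → CoreInv (x ∷ r) c′ → Inv (x ∷ r) (state (x ∷ seen) c′)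
Inv-new I x∉seen ci = record
  { seen⇒read = λ { (here e) → here e ; (there m) → there (seen⇒read I m) }
  ; read⇒seen = λ { (here e) → here e ; (there m) → there (read⇒seen I m) }
  ; free      = PatternFree-∷ (free I) (inj₁ (λ m → x∉seen (read⇒seen I m)))
  ; core-inv  = ci }

Inv-old : ∀ {r seen c c′ x} → Inv r (state seen c) → x ∈ r → CanRecur r x → CoreInv (x ∷ r) c′ →
  Inv (x ∷ r) (state seen c′)
Inv-old I x∈r x-recurs ci = record
  { seen⇒read = λ m → there (seen⇒read I m)
  ; read⇒seen = λ { (here refl) → read⇒seen I x∈r ; (there m) → read⇒seen I m }
  ; free      = PatternFree-∷ (free I) (inj₂ x-recurs)
  ; core-inv  = ci }

Inv-step : ∀ {singles r σ x σ′} → Inv r σ → Step singles σ x σ′ → Inv (x ∷ r) σ′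
Inv-step I (singleton {c = c} x∉seen) = Inv-new I x∉seen (weaken c (core-inv I))
  where
  weaken : ∀ c → CoreInv _ c → CoreInv (_ ∷ _) c
  weaken none                 _  = tt
  weaken (tracking _ _ _ _) ci = TrackingInv-∷ (λ m → x∉seen (read⇒seen I m)) ci
Inv-step I (first x∉seen)  = Inv-new I x∉seen (TrackingInv-first (λ m → x∉seen (read⇒seen I m)))
Inv-step I (fresh x∉seen)  = Inv-new I x∉seen (TrackingInv-fresh (λ m → x∉seen (read⇒seen I m)) (core-inv I))
Inv-step I again           = Inv-old I (current∈ (core-inv I)) (current-recurs (core-inv I))
                                       (TrackingInv-again (core-inv I))
Inv-step I (next PQ≡yR)    = Inv-old I (pending∈ (core-inv I) y∈PQ) (pending-recurs (core-inv I) y∈PQ)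
                                       (TrackingInv-next PQ≡yR (core-inv I))
  where
  y∈PQ = subst (_ ∈_) (sym PQ≡yR) (here refl)

MustRecur : Core → ℕ → Set
MustRecur none                 z = ⊥
MustRecur (tracking x₁ P Q s) z = (s ≡ true × z ≡ x₁) ⊎ z ∈ P ++ Q

Live : Core → ℕ → Set
Live none                 z = ⊥
Live (tracking x₁ P Q s) z = z ≡ x₁ ⊎ z ∈ P ++ Q

record Completes (singles : Bool) (σ : State) (v : List ℕ) : Set where
  field
    pending-occurs : ∀ z → MustRecur (core σ) z → z ∈ v
    dead-absent    : ∀ z → z ∈ seen σ → ¬ Live (core σ) z → z ∉ v
    new-twice      : singles ≡ false → ∀ z → z ∈ v → z ∉ seen σ → Twice z v
open Completes

MustRecur⇒Live : ∀ {c z} → MustRecur c z → Live c z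
MustRecur⇒Live {tracking _ _ _ _} (inj₁ (_ , e)) = inj₁ e
MustRecur⇒Live {tracking _ _ _ _} (inj₂ m)       = inj₂ m

Live⇒seen : ∀ {r σ z} → Inv r σ → Live (core σ) z → z ∈ seen σ
Live⇒seen {σ = state _ (tracking _ _ _ _)} I (inj₁ refl) = read⇒seen I (current∈ (core-inv I))
Live⇒seen {σ = state _ (tracking _ _ _ _)} I (inj₂ m)    = read⇒seen I (pending∈ (core-inv I) m)

∉-∷⁺ : ∀ {z x : ℕ} {v} → z ≢ x → z ∉ v → z ∉ x ∷ v
∉-∷⁺ z≢x z∉v (here e)  = z≢x e
∉-∷⁺ z≢x z∉v (there m) = z∉v m

∈-∷⁻ : ∀ {z x : ℕ} {v} → z ≢ x → z ∈ x ∷ v → z ∈ v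
∈-∷⁻ z≢x (here e)  = ⊥-elim (z≢x e)
∈-∷⁻ z≢x (there m) = m

Twice-∷⁻ : ∀ {z x : ℕ} {v} → z ≢ x → Twice z (x ∷ v) → Twice z v
Twice-∷⁻ z≢x p with ⊆-∷⁻ p
... | inj₁ p′      = p′
... | inj₂ (e , _) = ⊥-elim (z≢x e)

Twice-∷⇒∈ : ∀ {x : ℕ} {v} → Twice x (x ∷ v) → x ∈ v
Twice-∷⇒∈ p with ⊆-∷⁻ p
... | inj₁ p′      = second∈ p′
... | inj₂ (_ , p′) = to∈ p′

Accepting⇒¬MustRecur : ∀ c {z} → Accepting c → ¬ MustRecur c z
Accepting⇒¬MustRecur (tracking _ [] [] false) _ (inj₁ (() , _))
Accepting⇒¬MustRecur (tracking _ [] [] false) _ (inj₂ ())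

Completes-[]⇒Accepting : ∀ {singles} σ → Completes singles σ [] → Accepting (core σ)
Completes-[]⇒Accepting (state _ none)                      _ = tt
Completes-[]⇒Accepting (state _ (tracking _ [] [] false))  _ = tt
Completes-[]⇒Accepting (state _ (tracking x₁ [] [] true))  c with pending-occurs c x₁ (inj₁ (refl , refl))
... | ()
Completes-[]⇒Accepting (state _ (tracking _ [] (q ∷ _) _)) c with pending-occurs c q (inj₂ (here refl))
... | ()
Completes-[]⇒Accepting (state _ (tracking _ (p ∷ _) _ _))  c with pending-occurs c p (inj₂ (here refl))
... | ()

seen-mono : ∀ {singles σ x σ′ z} → Step singles σ x σ′ → z ∈ seen σ → z ∈ seen σ′
seen-mono (singleton _) m = there m
seen-mono (first _)     m = there m
seen-mono (fresh _)     m = there m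
seen-mono again         m = m
seen-mono (next _)      m = m

seen-step⁻ : ∀ {singles σ x σ′ z} → Step singles σ x σ′ → z ∈ seen σ′ → z ≡ x ⊎ z ∈ seen σ
seen-step⁻ (singleton _) (here e)  = inj₁ e
seen-step⁻ (singleton _) (there m) = inj₂ m
seen-step⁻ (first _)     (here e)  = inj₁ e
seen-step⁻ (first _)     (there m) = inj₂ m
seen-step⁻ (fresh _)     (here e)  = inj₁ e
seen-step⁻ (fresh _)     (there m) = inj₂ m
seen-step⁻ again         m         = inj₂ m
seen-step⁻ (next _)      m         = inj₂ m

read∈seen : ∀ {singles r σ x σ′} → Inv r σ → Step singles σ x σ′ → x ∈ seen σ′
read∈seen I (singleton _) = here refl
read∈seen I (first _)     = here refl
read∈seen I (fresh _)     = here refl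
read∈seen I again         = Live⇒seen I (inj₁ refl)
read∈seen I (next PQ≡yR)  = Live⇒seen I (inj₂ (subst (_ ∈_) (sym PQ≡yR) (here refl)))

read-new-or-live : ∀ {singles σ x σ′} → Step singles σ x σ′ → x ∉ seen σ ⊎ Live (core σ) x
read-new-or-live (singleton x∉) = inj₁ x∉
read-new-or-live (first x∉)     = inj₁ x∉
read-new-or-live (fresh x∉)     = inj₁ x∉
read-new-or-live again          = inj₂ (inj₁ refl)
read-new-or-live (next PQ≡yR)   = inj₂ (inj₂ (subst (_ ∈_) (sym PQ≡yR) (here refl)))

Live-step⁻ : ∀ {singles σ x σ′ z} → Step singles σ x σ′ → Live (core σ′) z → z ≡ x ⊎ Live (core σ) z
Live-step⁻ (singleton _)                 l        = inj₂ l
Live-step⁻ (first _)                     (inj₁ e) = inj₁ e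
Live-step⁻ (fresh _)                     (inj₁ e) = inj₂ (inj₁ e)
Live-step⁻ (fresh {P = P} {Q = Q} _)     (inj₂ m) = [ (λ m′ → inj₂ (inj₂ m′)) , inj₁ ]′ (∈-++-snoc⁻ P Q m)
Live-step⁻ again                         (inj₁ e) = inj₂ (inj₁ e)
Live-step⁻ (again {Q = Q})               (inj₂ m) = inj₂ (inj₂ (∈-++-[]⁻ Q m))
Live-step⁻ (next _)                      (inj₁ e) = inj₁ e
Live-step⁻ (next {R = R} PQ≡yR)          (inj₂ m) = inj₂ (inj₂ (subst (_ ∈_) (sym PQ≡yR) (there (∈-++-[]⁻ R m))))

MustRecur-step : ∀ {singles σ x σ′ z} → Step singles σ x σ′ → MustRecur (core σ) z → z ≡ x ⊎ MustRecur (core σ′) z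
MustRecur-step (singleton _)             p        = inj₂ p
MustRecur-step (fresh _)                 (inj₁ e) = inj₂ (inj₁ e)
MustRecur-step (fresh {P = P} {Q = Q} _) (inj₂ m) = inj₂ (inj₂ (subst (_ ∈_) (LP.++-assoc P Q _) (∈-++⁺ˡ m)))
MustRecur-step again                     (inj₁ (_ , e)) = inj₁ e
MustRecur-step again                     (inj₂ m) = inj₂ (inj₂ (∈-++⁺ˡ m))
MustRecur-step (next _)                  (inj₁ (() , _))
MustRecur-step (next PQ≡yR)              (inj₂ m) with subst (_ ∈_) PQ≡yR m
... | here e  = inj₁ e
... | there m′ = inj₂ (inj₂ (∈-++⁺ˡ m′))

MustRecur-step⁻ : ∀ {singles σ x σ′ z} → Step singles σ x σ′ → MustRecur (core σ′) z → z ≢ x → MustRecur (core σ) z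
MustRecur-step⁻ (singleton _)             p              _   = p
MustRecur-step⁻ (first _)                 (inj₁ (_ , e)) z≢x = ⊥-elim (z≢x e)
MustRecur-step⁻ (fresh _)                 (inj₁ e)       _   = inj₁ e
MustRecur-step⁻ (fresh {P = P} {Q = Q} _) (inj₂ m)       z≢x = [ inj₂ , (λ e → ⊥-elim (z≢x e)) ]′ (∈-++-snoc⁻ P Q m)
MustRecur-step⁻ (again {Q = Q})           (inj₂ m)       _   = inj₂ (∈-++-[]⁻ Q m)
MustRecur-step⁻ (next {R = R} PQ≡yR)      (inj₂ m)       _   = inj₂ (subst (_ ∈_) (sym PQ≡yR) (there (∈-++-[]⁻ R m)))

new-MustRecur : ∀ {singles r σ x σ′} → Inv r σ → Step singles σ x σ′ → x ∉ seen σ → singles ≡ false →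
  MustRecur (core σ′) x
new-MustRecur I (singleton _)             _   ()
new-MustRecur I (first _)                 _   _ = inj₁ (refl , refl)
new-MustRecur I (fresh {P = P} {Q = Q} _) _   _ = inj₂ (∈-++⁺ʳ P (∈-++⁺ʳ Q (here refl)))
new-MustRecur I again                     x∉ _ = ⊥-elim (x∉ (Live⇒seen I (inj₁ refl)))
new-MustRecur I (next PQ≡yR)              x∉ _ = ⊥-elim (x∉ (Live⇒seen I (inj₂ (subst (_ ∈_) (sym PQ≡yR) (here refl)))))

Completes-step⁻ : ∀ {singles r σ x σ′ v} → Inv r σ → Step singles σ x σ′ → Completes singles σ′ v →
  Completes singles σ (x ∷ v)
Completes-step⁻ {singles} {r} {σ} {x} {σ′} {v} I st c = record
  { pending-occurs = occurs ; dead-absent = absent ; new-twice = twice }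
  where
  occurs : ∀ z → MustRecur (core σ) z → z ∈ x ∷ v
  occurs z p = [ here , (λ p′ → there (pending-occurs c z p′)) ]′ (MustRecur-step st p)
  absent : ∀ z → z ∈ seen σ → ¬ Live (core σ) z → z ∉ x ∷ v
  absent z z∈ dead = ∉-∷⁺ z≢x (dead-absent c z (seen-mono st z∈) still-dead)
    where
    z≢x : z ≢ x
    z≢x refl = [ (λ x∉ → x∉ z∈) , dead ]′ (read-new-or-live st)
    still-dead : ¬ Live (core σ′) z
    still-dead l = [ z≢x , dead ]′ (Live-step⁻ st l)
  twice : singles ≡ false → ∀ z → z ∈ x ∷ v → z ∉ seen σ → Twice z (x ∷ v)
  twice singles≡false z m z∉ with z ℕP.≟ x
  ... | yes refl = refl ∷ from∈ (pending-occurs c z (new-MustRecur I st z∉ singles≡false))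
  ... | no z≢x   = x ∷ʳ new-twice c singles≡false z (∈-∷⁻ z≢x m) (λ m′ → [ z≢x , z∉ ]′ (seen-step⁻ st m′))

Lookahead : ∀ {singles σ x σ′} → Step singles σ x σ′ → List ℕ → Set
Lookahead {x = x} (singleton _) v = x ∉ v
Lookahead {x = x} (first _)     v = x ∈ v
Lookahead {x = x} (fresh _)     v = x ∈ v
Lookahead again                 v = ⊤
Lookahead (next _)              v = ⊤

read-dead⇒absent : ∀ {singles σ x σ′ v} (st : Step singles σ x σ′) → Lookahead st v → ¬ Live (core σ′) x → x ∉ v
read-dead⇒absent (singleton _)             look _    = look
read-dead⇒absent (first _)                 _    dead = ⊥-elim (dead (inj₁ refl))
read-dead⇒absent (fresh {P = P} {Q = Q} _) _    dead = ⊥-elim (dead (inj₂ (∈-++⁺ʳ P (∈-++⁺ʳ Q (here refl)))))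
read-dead⇒absent again                     _    dead = ⊥-elim (dead (inj₁ refl))
read-dead⇒absent (next _)                  _    dead = ⊥-elim (dead (inj₁ refl))

Dropped : ∀ {singles σ x σ′} → Step singles σ x σ′ → ℕ → Set
Dropped (next {x₁ = x₁} _) z = z ≡ x₁
Dropped (singleton _)      z = ⊥
Dropped (first _)          z = ⊥
Dropped (fresh _)          z = ⊥
Dropped again              z = ⊥

dead-step⁻ : ∀ {singles σ x σ′ z} (st : Step singles σ x σ′) → ¬ Live (core σ′) z → ¬ Live (core σ) z ⊎ Dropped st z
dead-step⁻ (singleton _)             dead = inj₁ dead
dead-step⁻ (first _)                 dead = inj₁ (λ ())
dead-step⁻ (fresh {P = P} {Q = Q} _) dead = inj₁ λ
  { (inj₁ e) → dead (inj₁ e) ; (inj₂ m) → dead (inj₂ (subst (_ ∈_) (LP.++-assoc P Q _) (∈-++⁺ˡ m))) }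
dead-step⁻ again                     dead = inj₁ λ { (inj₁ e) → dead (inj₁ e) ; (inj₂ m) → dead (inj₂ (∈-++⁺ˡ m)) }
dead-step⁻ {z = z} (next {x₁ = x₁} {P = P} {Q = Q} PQ≡yR) dead with z ℕP.≟ x₁
... | yes z≡x₁ = inj₂ z≡x₁
... | no z≢x₁  = inj₁ still-dead
  where
  still-dead : ¬ Live (tracking x₁ P Q false) z
  still-dead (inj₁ e) = z≢x₁ e
  still-dead (inj₂ m) with subst (z ∈_) PQ≡yR m
  ... | here e  = dead (inj₁ e)
  ... | there m′ = dead (inj₂ (∈-++⁺ˡ m′))

-- an earlier y follows some x₁, so an x₁ after the y just read would complete x₁ y y x₁
Dropped⇒absent : ∀ {singles r σ x σ′ v z} → Inv r σ → PatternFree (r ʳ++ (x ∷ v)) → (st : Step singles σ x σ′) →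
  Dropped st z → z ∉ v
Dropped⇒absent {x = y} I free-rv (next PQ≡yR) refl z∈v =
  free-rv _ y (λ x₁≡y → pending≢current (core-inv I) y∈PQ (sym x₁≡y))
              (pattern-closes (current-before (core-inv I) y∈PQ) z∈v)
  where
  y∈PQ = subst (y ∈_) (sym PQ≡yR) (here refl)

Completes-step : ∀ {singles r σ x σ′ v} → Inv r σ → PatternFree (r ʳ++ (x ∷ v)) → Completes singles σ (x ∷ v) →
  (st : Step singles σ x σ′) → Lookahead st v → Completes singles σ′ v
Completes-step {singles} {r} {σ} {x} {σ′} {v} I free-rv c st look = record
  { pending-occurs = occurs st look ; dead-absent = absent ; new-twice = twice }
  where
  twice : singles ≡ false → ∀ z → z ∈ v → z ∉ seen σ′ → Twice z v
  twice singles≡false z m z∉ = Twice-∷⁻ z≢x (new-twice c singles≡false z (there m) (λ m′ → z∉ (seen-mono st m′)))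
    where
    z≢x : z ≢ x
    z≢x refl = z∉ (read∈seen I st)
  occurs : (st : Step singles σ x σ′) → Lookahead st v → ∀ z → MustRecur (core σ′) z → z ∈ v
  occurs st look z p with z ℕP.≟ x
  occurs st look z p | no z≢x = ∈-∷⁻ z≢x (pending-occurs c z (MustRecur-step⁻ st p z≢x))
  occurs (singleton x∉) look z p | yes refl = ⊥-elim (x∉ (Live⇒seen I (MustRecur⇒Live p)))
  occurs (first _)      look z p | yes refl = look
  occurs (fresh _)      look z p | yes refl = look
  occurs (again {Q = Q}) look z (inj₂ m) | yes refl =
    ⊥-elim (pending≢current (core-inv I) (∈-++-[]⁻ Q m) refl)
  occurs (next {R = R} PQ≡yR) look z (inj₂ m) | yes refl =
    ⊥-elim (proj₁ (proj₁ (subst (Ordered r) PQ≡yR (ordered (core-inv I))) z (∈-++-[]⁻ R m)) refl)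
  absent : ∀ z → z ∈ seen σ′ → ¬ Live (core σ′) z → z ∉ v
  absent z z∈ dead with z ℕP.≟ x
  ... | yes refl = read-dead⇒absent st look dead
  ... | no z≢x   = [ (λ dead-before z∈v → dead-absent c z z∈seen dead-before (there z∈v)) , Dropped⇒absent I free-rv st ]′
                     (dead-step⁻ st dead)
    where
    z∈seen = [ (λ z≡x → ⊥-elim (z≢x z≡x)) , id ]′ (seen-step⁻ st z∈)

StepWithLookahead : Bool → State → ℕ → List ℕ → Set
StepWithLookahead singles σ x v = Σ State (λ σ′ → Σ (Step singles σ x σ′) (λ st → Lookahead st v))

recurring-step : ∀ {singles seen x v} c → x ∉ seen → x ∈ v → StepWithLookahead singles (state seen c) x v
recurring-step none                 x∉ x∈v = _ , first x∉ , x∈v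
recurring-step (tracking _ _ _ _) x∉ x∈v = _ , fresh x∉ , x∈v

live-step : ∀ {singles r seen x₁ P Q s x v} → Inv r (state seen (tracking x₁ P Q s)) → PatternFree (r ʳ++ (x ∷ v)) →
  Completes singles (state seen (tracking x₁ P Q s)) (x ∷ v) → Live (tracking x₁ P Q s) x →
  StepWithLookahead singles (state seen (tracking x₁ P Q s)) x v
live-step {P = []}    I free c (inj₁ refl) = _ , again , tt
live-step {x₁ = x₁} {P = ℓ ∷ P} I free c (inj₁ refl) =
  ⊥-elim (free ℓ x₁ ℓ≢x₁ (pattern-closes (P-before-current (core-inv I) (here refl))
                                          (∈-∷⁻ ℓ≢x₁ (pending-occurs c ℓ (inj₂ (here refl))))))
  where
  ℓ≢x₁ = pending≢current (core-inv I) (here refl)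
live-step {r = r} {x₁ = x₁} {P} {Q} {s} {x} I free c (inj₂ x∈PQ) with P ++ Q in PQ≡ | x∈PQ
... | y ∷ R | x∈yR with x ℕP.≟ y
...   | no x≢y = ⊥-elim (free y x (λ y≡x → x≢y (sym y≡x))
                   (pattern-closes (proj₁ (proj₂ (proj₁ ord x (∈-∷⁻ x≢y x∈yR))))
                                   (∈-∷⁻ (λ y≡x → x≢y (sym y≡x)) (pending-occurs c y (inj₂ y∈PQ)))))
  where
  ord = subst (Ordered r) PQ≡ (ordered (core-inv I))
  y∈PQ = subst (y ∈_) (sym PQ≡) (here refl)
...   | yes refl with s
...     | false = _ , next PQ≡ , tt
...     | true  = ⊥-elim (free x₁ x (λ x₁≡x → x≢x₁ (sym x₁≡x))
                   (pattern-closes (current-before (core-inv I) x∈PQ′)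
                                   (∈-∷⁻ (λ x₁≡x → x≢x₁ (sym x₁≡x)) (pending-occurs c x₁ (inj₁ (refl , refl))))))
  where
  x∈PQ′ = subst (x ∈_) (sym PQ≡) (here refl)
  x≢x₁ = pending≢current (core-inv I) x∈PQ′

step-exists : ∀ {singles r σ x v} → Inv r σ → PatternFree (r ʳ++ (x ∷ v)) → Completes singles σ (x ∷ v) →
  StepWithLookahead singles σ x v
step-exists {singles} {σ = σ} {x} {v} I free c with x ∈? seen σ | x ∈? v
... | no x∉ | yes x∈v = recurring-step (core σ) x∉ x∈v
... | no x∉ | no x∉v with singles
...   | true  = _ , singleton x∉ , x∉v
...   | false = ⊥-elim (x∉v (Twice-∷⇒∈ (new-twice c refl x (here refl) x∉)))
step-exists {σ = state seen none} {x} I free c | yes x∈ | _ = ⊥-elim (dead-absent c x x∈ (λ ()) (here refl))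
step-exists {σ = state seen (tracking x₁ P Q s)} {x} I free c | yes x∈ | _ with x ℕP.≟ x₁ | x ∈? P ++ Q
... | yes x≡x₁ | _       = live-step I free c (inj₁ x≡x₁)
... | no _     | yes x∈L = live-step I free c (inj₂ x∈L)
... | no x≢x₁  | no x∉L  = ⊥-elim (dead-absent c x x∈ [ x≢x₁ , x∉L ]′ (here refl))

Run⇔ : ∀ singles {r σ} → Inv r σ → ∀ v →
  (Run singles σ v → PatternFree (r ʳ++ v) × Completes singles σ v)
  × (PatternFree (r ʳ++ v) → Completes singles σ v → Run singles σ v)
Run⇔ singles {r} {σ} I [] =
  (λ acc → PatternFree-reverse (free I) , record
     { pending-occurs = λ z p → ⊥-elim (Accepting⇒¬MustRecur (core σ) acc p)
     ; dead-absent    = λ _ _ _ ()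
     ; new-twice      = λ _ _ () })
  , (λ _ c → Completes-[]⇒Accepting σ c)
Run⇔ singles {r} {σ} I (x ∷ v) =
  (λ { (σ′ , st , run) → let (free-rv , c) = proj₁ (Run⇔ singles (Inv-step I st) v) run
                         in free-rv , Completes-step⁻ I st c })
  , (λ free-rv c → let (σ′ , st , look) = step-exists I free-rv c
                   in σ′ , st , proj₂ (Run⇔ singles (Inv-step I st) v) free-rv (Completes-step I free-rv c st look))

initial : State
initial = state [] none

Inv-initial : Inv [] initial
Inv-initial = record
  { seen⇒read = λ () ; read⇒seen = λ () ; free = λ _ _ _ p → ∉[] (to∈ p) ; core-inv = tt }
  where
  ∉[] : ∀ {a : ℕ} → a ∉ []
  ∉[] ()

accepts⇔ : ∀ singles w → (Run singles initial w → PatternFree w × (singles ≡ false → ∀ z → z ∈ w → Twice z w))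
                   × (PatternFree w → (singles ≡ false → ∀ z → z ∈ w → Twice z w) → Run singles initial w)
accepts⇔ singles w =
  (λ run → let (free-w , c) = proj₁ (Run⇔ singles Inv-initial w) run
           in free-w , (λ singles≡false z m → new-twice c singles≡false z m (λ ())))
  , (λ free-w twice → proj₂ (Run⇔ singles Inv-initial w) free-w record
       { pending-occurs = λ _ () ; dead-absent = λ _ () ; new-twice = λ singles≡false z m _ → twice singles≡false z m })

-- Set partitions as words

Increasing : ∀ {k n} → (Fin k → Fin n) → Set
Increasing f = ∀ a b → a Fin.< b → f a Fin.< f b

Fin-pred : ∀ {n} (i : Fin (suc n)) → 0 ℕ.< toℕ i → Fin n
Fin-pred (Fin.suc i) _ = i

suc-Fin-pred : ∀ {n} (i : Fin (suc n)) (i>0 : 0 ℕ.< toℕ i) → Fin.suc (Fin-pred i i>0) ≡ i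
suc-Fin-pred (Fin.suc i) _ = refl

Fin-pred-< : ∀ {n} (i j : Fin (suc n)) i>0 j>0 → i Fin.< j → Fin-pred i i>0 Fin.< Fin-pred j j>0
Fin-pred-< (Fin.suc i) (Fin.suc j) _ _ (s≤s i<j) = i<j

increasing⇒⊆ : ∀ {n k} (π : Vec ℕ n) (f : Fin k → Fin n) → Increasing f → tabulate (lookup π ∘ f) ⊆ toList π
increasing⇒⊆ {k = zero}  π        f inc = minimum (toList π)
increasing⇒⊆ {k = suc k} []       f inc with f Fin.zero
... | ()
increasing⇒⊆ {k = suc k} (x ∷ π) f inc with f Fin.zero FinP.≟ Fin.zero
... | yes f0≡0 =
  cong (lookup (x ∷ π)) f0≡0 ∷ subst (_⊆ toList π) (LP.tabulate-cong (λ a → cong (lookup (x ∷ π)) (suc-Fin-pred _ (pos a))))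
                                    (increasing⇒⊆ π (λ a → Fin-pred (f (Fin.suc a)) (pos a))
                                                    (λ a b a<b → Fin-pred-< _ _ (pos a) (pos b) (inc _ _ (s≤s a<b))))
  where
  pos : ∀ a → 0 ℕ.< toℕ (f (Fin.suc a))
  pos a = subst (λ i → toℕ i ℕ.< toℕ (f (Fin.suc a))) f0≡0 (inc Fin.zero (Fin.suc a) (s≤s z≤n))
... | no f0≢0 =
  x ∷ʳ subst (_⊆ toList π) (LP.tabulate-cong (λ a → cong (lookup (x ∷ π)) (suc-Fin-pred _ (pos a))))
               (increasing⇒⊆ π (λ a → Fin-pred (f a) (pos a)) (λ a b a<b → Fin-pred-< _ _ (pos a) (pos b) (inc a b a<b)))
  where
  nonzero : ∀ {m} (i : Fin (suc m)) → i ≢ Fin.zero → 0 ℕ.< toℕ i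
  nonzero Fin.zero    i≢0 = ⊥-elim (i≢0 refl)
  nonzero (Fin.suc i) _   = s≤s z≤n
  pos0 : 0 ℕ.< toℕ (f Fin.zero)
  pos0 = nonzero (f Fin.zero) f0≢0
  pos : ∀ a → 0 ℕ.< toℕ (f a)
  pos Fin.zero    = pos0
  pos (Fin.suc a) = ℕP.<-trans pos0 (inc Fin.zero (Fin.suc a) (s≤s z≤n))

⊆⇒increasing : ∀ {n} (π : Vec ℕ n) xs → xs ⊆ toList π →
  Σ (Fin (length xs) → Fin n) (λ f → Increasing f × (∀ i → lookup π (f i) ≡ L.lookup xs i))
⊆⇒increasing []      L.[] [] = (λ ()) , (λ ()) , (λ ())
⊆⇒increasing (x ∷ π) xs   (.x ∷ʳ p) =
  let (f , inc , f-lookup) = ⊆⇒increasing π xs p in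
  Fin.suc ∘ f , (λ a b a<b → s≤s (inc a b a<b)) , f-lookup
⊆⇒increasing (x ∷ π) (.x L.∷ xs) (refl ∷ p) =
  let (f , inc , f-lookup) = ⊆⇒increasing π xs p in
  extend f , extend-inc f inc , extend-lookup f f-lookup
  where
  extend : (Fin (length xs) → Fin _) → Fin (suc (length xs)) → Fin (suc _)
  extend f Fin.zero    = Fin.zero
  extend f (Fin.suc i) = Fin.suc (f i)
  extend-inc : ∀ f → Increasing f → Increasing (extend f)
  extend-inc f inc Fin.zero    (Fin.suc b) _         = s≤s z≤n
  extend-inc f inc (Fin.suc a) (Fin.suc b) (s≤s a<b) = s≤s (inc a b a<b)
  extend-lookup : ∀ f → (∀ i → lookup π (f i) ≡ L.lookup xs i) → ∀ i →
    lookup (x ∷ π) (extend f i) ≡ L.lookup (x L.∷ xs) i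
  extend-lookup f f-lookup Fin.zero    = refl
  extend-lookup f f-lookup (Fin.suc i) = f-lookup i

inner : Fin 4 → Bool
inner Fin.zero                               = false
inner (Fin.suc Fin.zero)                     = true
inner (Fin.suc (Fin.suc Fin.zero))           = true
inner (Fin.suc (Fin.suc (Fin.suc Fin.zero))) = false

lookup-Pattern : ∀ a b i → L.lookup (Pattern a b) i ≡ (if inner i then b else a)
lookup-Pattern a b Fin.zero                               = refl
lookup-Pattern a b (Fin.suc Fin.zero)                     = refl
lookup-Pattern a b (Fin.suc (Fin.suc Fin.zero))           = refl
lookup-Pattern a b (Fin.suc (Fin.suc (Fin.suc Fin.zero))) = refl

lookup-14/23 : ∀ i → lookup p14/23 i ≡ (if inner i then 1 else 0)
lookup-14/23 Fin.zero                               = refl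
lookup-14/23 (Fin.suc Fin.zero)                     = refl
lookup-14/23 (Fin.suc (Fin.suc Fin.zero))           = refl
lookup-14/23 (Fin.suc (Fin.suc (Fin.suc Fin.zero))) = refl

if-injective : ∀ {a b : ℕ} → a ≢ b → ∀ c d → (if c then b else a) ≡ (if d then b else a) → c ≡ d
if-injective a≢b false false _ = refl
if-injective a≢b false true  e = ⊥-elim (a≢b e)
if-injective a≢b true  false e = ⊥-elim (a≢b (sym e))
if-injective a≢b true  true  _ = refl

0≢1 : 0 ≢ 1
0≢1 ()

Contains⇒Pattern : ∀ {n} (π : Vec ℕ n) → Contains π p14/23 →
  Σ ℕ (λ a → Σ ℕ (λ b → a ≢ b × Pattern a b ⊆ toList π))
Contains⇒Pattern π (f , inc , same) = a , b , a≢b , subst (_⊆ toList π) word (increasing⇒⊆ π f inc)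
  where
  at : Fin 4 → ℕ
  at i = lookup π (f i)
  a = at Fin.zero
  b = at (Fin.suc Fin.zero)
  a≢b : a ≢ b
  a≢b e = 0≢1 (proj₁ (same Fin.zero (Fin.suc Fin.zero)) e)
  word : tabulate at ≡ Pattern a b
  word = cong (λ t → a L.∷ b L.∷ t) (cong₂ L._∷_ (sym (proj₂ (same (Fin.suc Fin.zero) (Fin.suc (Fin.suc Fin.zero))) refl))
                                          (cong (L._∷ L.[]) (sym (proj₂ (same Fin.zero (Fin.suc (Fin.suc (Fin.suc Fin.zero)))) refl))))

Pattern⇒Contains : ∀ {n} (π : Vec ℕ n) a b → a ≢ b → Pattern a b ⊆ toList π → Contains π p14/23
Pattern⇒Contains π a b a≢b p = f , inc , λ i j → to i j , from i j
  where
  f = proj₁ (⊆⇒increasing π (Pattern a b) p)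
  inc = proj₁ (proj₂ (⊆⇒increasing π (Pattern a b) p))
  at-f : ∀ i → lookup π (f i) ≡ (if inner i then b else a)
  at-f i = trans (proj₂ (proj₂ (⊆⇒increasing π (Pattern a b) p)) i) (lookup-Pattern a b i)
  to : ∀ i j → SameBlock π (f i) (f j) → SameBlock p14/23 i j
  to i j e = trans (lookup-14/23 i) (trans (cong (λ c → if c then 1 else 0) inner≡) (sym (lookup-14/23 j)))
    where
    inner≡ = if-injective a≢b (inner i) (inner j) (trans (sym (at-f i)) (trans e (at-f j)))
  from : ∀ i j → SameBlock p14/23 i j → SameBlock π (f i) (f j)
  from i j e = trans (at-f i) (trans (cong (λ c → if c then b else a) inner≡) (sym (at-f j)))
    where
    inner≡ = if-injective 0≢1 (inner i) (inner j) (trans (sym (lookup-14/23 i)) (trans e (lookup-14/23 j)))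

Avoids⇔PatternFree : ∀ {n} (π : Vec ℕ n) →
  (Avoids π p14/23 → PatternFree (toList π)) × (PatternFree (toList π) → Avoids π p14/23)
Avoids⇔PatternFree π =
  (λ avoids a b a≢b p → avoids (Pattern⇒Contains π a b a≢b p))
  , (λ free contains → let (a , b , a≢b , p) = Contains⇒Pattern π contains in free a b a≢b p)

∈-toList⁻ : ∀ {n} (π : Vec ℕ n) {z} → z ∈ toList π → Σ (Fin n) (λ i → lookup π i ≡ z)
∈-toList⁻ (x ∷ π) (here e)  = Fin.zero , sym e
∈-toList⁻ (x ∷ π) (there m) = let (i , e) = ∈-toList⁻ π m in Fin.suc i , e

∈-toList⁺ : ∀ {n} (π : Vec ℕ n) i → lookup π i ∈ toList π
∈-toList⁺ (x ∷ π) Fin.zero    = here refl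
∈-toList⁺ (x ∷ π) (Fin.suc i) = there (∈-toList⁺ π i)

pair : ∀ {n} → Fin n → Fin n → Fin 2 → Fin n
pair i j Fin.zero           = i
pair i j (Fin.suc Fin.zero) = j

pair-increasing : ∀ {n} (i j : Fin n) → i Fin.< j → Increasing (pair i j)
pair-increasing i j i<j Fin.zero           (Fin.suc Fin.zero) _ = i<j
pair-increasing i j i<j (Fin.suc Fin.zero) (Fin.suc Fin.zero) (s≤s ())

NoSingletons⇒Twice : ∀ {n} (π : Vec ℕ n) → NoSingletons π → ∀ z → z ∈ toList π → Twice z (toList π)
NoSingletons⇒Twice π no-singletons z m with ∈-toList⁻ π m
... | i , refl with no-singletons i
...   | j , j≢i , same with FinP.<-cmp i j
...     | tri< i<j _ _ =
  subst (λ t → lookup π i L.∷ t L.∷ L.[] ⊆ toList π) (sym same) (increasing⇒⊆ π (pair i j) (pair-increasing i j i<j))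
...     | tri≈ _ i≡j _ = ⊥-elim (j≢i (sym i≡j))
...     | tri> _ _ j<i =
  subst (λ t → t L.∷ lookup π i L.∷ L.[] ⊆ toList π) (sym same) (increasing⇒⊆ π (pair j i) (pair-increasing j i j<i))

Twice⇒NoSingletons : ∀ {n} (π : Vec ℕ n) → (∀ z → z ∈ toList π → Twice z (toList π)) → NoSingletons π
Twice⇒NoSingletons π twice i with ⊆⇒increasing π _ (twice (lookup π i) (∈-toList⁺ π i))
... | f , inc , f-lookup with f Fin.zero FinP.≟ i
...   | no f0≢i  = f Fin.zero , f0≢i , sym (f-lookup Fin.zero)
...   | yes f0≡i = f (Fin.suc Fin.zero) , f1≢i , sym (f-lookup (Fin.suc Fin.zero))
  where
  f1≢i : f (Fin.suc Fin.zero) ≢ i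
  f1≢i f1≡i = ℕP.<-irrefl (cong toℕ (trans f0≡i (sym f1≡i))) (inc Fin.zero (Fin.suc Fin.zero) (s≤s z≤n))

-- Counting accepted words

HasCount-⇔ : ∀ {A : Set} {P Q : A → Set} {c} → (∀ x → P x → Q x) → (∀ x → Q x → P x) → HasCount P c → HasCount Q c
HasCount-⇔ P⇒Q Q⇒P (f , f-inj , f-P , f-onto) = f , f-inj , (λ i → P⇒Q _ (f-P i)) , (λ x q → f-onto x (Q⇒P x q))

HasCount-unique : ∀ {A : Set} {P : A → Set} {a b} → HasCount P a → HasCount P b → a ≡ b
HasCount-unique countA countB = ℕP.≤-antisym (≤ countA countB) (≤ countB countA)
  where
  ≤ : ∀ {A : Set} {P : A → Set} {a b} → HasCount P a → HasCount P b → a ℕ.≤ b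
  ≤ (f , f-inj , f-P , _) (g , _ , _ , g-onto) = FinP.injective⇒≤ {f = h} h-inj
    where
    h = λ i → proj₁ (g-onto (f i) (f-P i))
    h-inj : ∀ {i j} → h i ≡ h j → i ≡ j
    h-inj {i} {j} e = f-inj (trans (sym (proj₂ (g-onto (f i) (f-P i)))) (trans (cong g e) (proj₂ (g-onto (f j) (f-P j)))))

HasCount-empty : ∀ {A : Set} {P : A → Set} → (∀ x → ¬ P x) → HasCount P 0
HasCount-empty ¬P = (λ ()) , (λ {i} → ⊥-elim (FinP.¬Fin0 i)) , (λ ()) , (λ x p → ⊥-elim (¬P x p))

HasCount-[] : ∀ {P : Vec ℕ 0 → Set} → P [] → HasCount P 1
HasCount-[] p = (λ _ → []) , (λ { {Fin.zero} {Fin.zero} _ → refl }) , (λ _ → p) , (λ { [] _ → Fin.zero , refl })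

StartsWith : ∀ {n} → ℕ → (Vec ℕ n → Set) → Vec ℕ (suc n) → Set
StartsWith x P (y ∷ v) = y ≡ x × P v

HasCount-∷ : ∀ {n c} x {P : Vec ℕ n → Set} → HasCount P c → HasCount (StartsWith x P) c
HasCount-∷ x (f , f-inj , f-P , f-onto) =
  (λ i → x ∷ f i) , (λ e → f-inj (cong V.tail e)) , (λ i → refl , f-P i) ,
  (λ { (y ∷ v) (refl , p) → let (i , e) = f-onto v p in i , cong (x ∷_) e })

HasCount-⊎ : ∀ {A : Set} {P Q : A → Set} {a b} → HasCount P a → HasCount Q b → (∀ x → P x → Q x → ⊥) →
  HasCount (λ x → P x ⊎ Q x) (a ℕ.+ b)
HasCount-⊎ {A} {P} {Q} {a} {b} (f , f-inj , f-P , f-onto) (g , g-inj , g-Q , g-onto) disjoint = h , h-inj , h-PQ , h-onto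
  where
  h : Fin (a ℕ.+ b) → A
  h k = [ f , g ]′ (splitAt a k)
  split-inj : ∀ s s′ → [ f , g ]′ s ≡ [ f , g ]′ s′ → s ≡ s′
  split-inj (inj₁ i) (inj₁ i′) e = cong inj₁ (f-inj e)
  split-inj (inj₁ i) (inj₂ j)  e = ⊥-elim (disjoint _ (f-P i) (subst Q (sym e) (g-Q j)))
  split-inj (inj₂ j) (inj₁ i)  e = ⊥-elim (disjoint _ (f-P i) (subst Q e (g-Q j)))
  split-inj (inj₂ j) (inj₂ j′) e = cong inj₂ (g-inj e)
  h-inj : ∀ {k k′} → h k ≡ h k′ → k ≡ k′
  h-inj {k} {k′} e = trans (sym (FinP.join-splitAt a b k))
                           (trans (cong (Fin.join a b) (split-inj (splitAt a k) (splitAt a k′) e)) (FinP.join-splitAt a b k′))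
  h-PQ : ∀ k → P (h k) ⊎ Q (h k)
  h-PQ k with splitAt a k
  ... | inj₁ i = inj₁ (f-P i)
  ... | inj₂ j = inj₂ (g-Q j)
  h-onto : ∀ x → P x ⊎ Q x → ∃ λ k → h k ≡ x
  h-onto x (inj₁ p) = let (i , e) = f-onto x p in i ↑ˡ b , trans (cong [ f , g ]′ (FinP.splitAt-↑ˡ a i b)) e
  h-onto x (inj₂ q) = let (j , e) = g-onto x q in a ↑ʳ j , trans (cong [ f , g ]′ (FinP.splitAt-↑ʳ a b j)) e

HasCount-when : ∀ (b : Bool) {A : Set} {P : A → Set} {c} → (b ≡ true → HasCount P c) →
  HasCount (λ x → b ≡ true × P x) (if b then c else 0)
HasCount-when true  count = HasCount-⇔ (λ _ p → refl , p) (λ _ → proj₂) (count refl)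
HasCount-when false _     = HasCount-empty (λ _ ())

data Shape : Set where
  idle   : Shape
  active : ℕ → ℕ → Bool → Shape

accepting : Shape → ℕ
accepting idle                  = 1
accepting (active 0 0 false)    = 1
accepting (active 0 0 true)     = 0
accepting (active 0 (suc q) s)  = 0
accepting (active (suc p) q s)  = 0

repeatCurrent : (Shape → ℕ) → ℕ → ℕ → ℕ
repeatCurrent f zero    q = f (active q 0 false)
repeatCurrent f (suc p) q = 0

advance : (Shape → ℕ) → ℕ → Bool → ℕ
advance f zero    s     = 0
advance f (suc r) false = f (active r 0 false)
advance f (suc r) true  = 0

-- the three summands count the steps fresh, again and next; first is the only step from idle
successors : (Shape → ℕ) → Shape → ℕ
successors f idle           = f (active 0 0 true)
successors f (active p q s) = f (active p (suc q) s) ℕ.+ repeatCurrent f p q ℕ.+ advance f (p ℕ.+ q) s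

accepted : Bool → ℕ → Shape → ℕ
accepted singles zero    sh = accepting sh
accepted singles (suc n) sh =
  (if singles then accepted singles n sh else 0) ℕ.+ successors (accepted singles n) sh

shape : Core → Shape
shape none                = idle
shape (tracking _ P Q s) = active (length P) (length Q) s

AcceptedFrom : Bool → ℕ → State → ∀ {n} → Vec ℕ n → Set
AcceptedFrom singles m σ v = RGS-from m v × Run singles σ (toList v)

record Reachable (m : ℕ) (σ : State) : Set where
  field
    seen⇒< : ∀ {z} → z ∈ seen σ → z ℕ.< m
    <⇒seen : ∀ {z} → z ℕ.< m → z ∈ seen σ
    read   : List ℕ
    inv    : Inv read σ
open Reachable

Reachable-initial : Reachable 0 initial
Reachable-initial = record { seen⇒< = λ () ; <⇒seen = λ () ; read = L.[] ; inv = Inv-initial }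

new-label≡ : ∀ {m σ x} → Reachable m σ → x ℕ.≤ m → x ∉ seen σ → x ≡ m
new-label≡ R x≤m x∉ with ℕP.m≤n⇒m<n∨m≡n x≤m
... | inj₁ x<m = ⊥-elim (x∉ (<⇒seen R x<m))
... | inj₂ x≡m = x≡m

m∉seen : ∀ {m σ} → Reachable m σ → m ∉ seen σ
m∉seen R m∈ = ℕP.<-irrefl refl (seen⇒< R m∈)

Live⇒< : ∀ {m σ z} → Reachable m σ → Live (core σ) z → z ℕ.< m
Live⇒< R l = seen⇒< R (Live⇒seen (inv R) l)

Reachable-new : ∀ {singles m seen c c′} → Reachable m (state seen c) →
  Step singles (state seen c) m (state (m L.∷ seen) c′) →
  Reachable (suc m) (state (m L.∷ seen) c′)
Reachable-new {m = m} R st = record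
  { seen⇒< = λ { (here refl) → ℕP.≤-refl ; (there z∈) → ℕP.m≤n⇒m≤1+n (seen⇒< R z∈) }
  ; <⇒seen = λ { (s≤s z≤m) → [ (λ z<m → there (<⇒seen R z<m)) , here ]′ (ℕP.m≤n⇒m<n∨m≡n z≤m) }
  ; read   = m L.∷ read R
  ; inv    = Inv-step (inv R) st }

Reachable-old : ∀ {singles m seen c c′ x} → Reachable m (state seen c) →
  Step singles (state seen c) x (state seen c′) →
  Reachable m (state seen c′)
Reachable-old {x = x} R st = record
  { seen⇒< = seen⇒< R ; <⇒seen = <⇒seen R ; read = x L.∷ read R ; inv = Inv-step (inv R) st }

RGS-new : ∀ {n m} {v : Vec ℕ n} → RGS-from (m ⊔ suc m) v ≡ RGS-from (suc m) v
RGS-new {m = m} = cong (λ t → RGS-from t _) (ℕP.m≤n⇒m⊔n≡n (ℕP.n≤1+n m))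

RGS-old : ∀ {n m x} {v : Vec ℕ n} → x ℕ.< m → RGS-from (m ⊔ suc x) v ≡ RGS-from m v
RGS-old x<m = cong (λ t → RGS-from t _) (ℕP.m≥n⇒m⊔n≡m x<m)

Run⇒dead-absent : ∀ {singles r σ v z} → Inv r σ → Run singles σ v → z ∈ seen σ → ¬ Live (core σ) z → z ∉ v
Run⇒dead-absent {singles} {v = v} I run = dead-absent (proj₂ (proj₁ (Run⇔ singles I v) run)) _

Run⇒pending-occurs : ∀ {singles r σ v z} → Inv r σ → Run singles σ v → MustRecur (core σ) z → z ∈ v
Run⇒pending-occurs {singles} {v = v} I run = pending-occurs (proj₂ (proj₁ (Run⇔ singles I v) run)) _

count-zero : ∀ singles m σ → HasCount (AcceptedFrom singles m σ {0}) (accepted singles 0 (shape (core σ)))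
count-zero singles m (state _ none)                         = HasCount-[] (tt , tt)
count-zero singles m (state _ (tracking _ L.[] L.[] false))  = HasCount-[] (tt , tt)
count-zero singles m (state _ (tracking _ L.[] L.[] true))   = HasCount-empty (λ { [] (_ , ()) })
count-zero singles m (state _ (tracking _ L.[] (_ L.∷ _) _)) = HasCount-empty (λ { [] (_ , ()) })
count-zero singles m (state _ (tracking _ (_ L.∷ _) _ _))    = HasCount-empty (λ { [] (_ , ()) })

module CountStep (singles : Bool) (n : ℕ)
  (IH : ∀ m σ → Reachable m σ → HasCount (AcceptedFrom singles m σ {n}) (accepted singles n (shape (core σ)))) where

  SingletonBranch NewBranch : ℕ → List ℕ → Core → Vec ℕ (suc n) → Set
  SingletonBranch m seen c v = singles ≡ true × StartsWith m (AcceptedFrom singles (suc m) (state (m L.∷ seen) c)) v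
  NewBranch m seen c′      = StartsWith m (AcceptedFrom singles (suc m) (state (m L.∷ seen) c′))

  singleton-step : ∀ {m seen c} → Reachable m (state seen c) → singles ≡ true →
    Step singles (state seen c) m (state (m L.∷ seen) c)
  singleton-step R singles≡true = subst (λ b → Step b _ _ _) (sym singles≡true) (singleton (m∉seen R))

  count-singleton : ∀ {m seen c} → Reachable m (state seen c) →
    HasCount (SingletonBranch m seen c) (if singles then accepted singles n (shape c) else 0)
  count-singleton {m} R =
    HasCount-when singles (λ singles≡true → HasCount-∷ m (IH (suc m) _ (Reachable-new R (singleton-step R singles≡true))))

  count-new : ∀ {m seen c c′} → Reachable m (state seen c) → Step singles (state seen c) m (state (m L.∷ seen) c′) →
    HasCount (NewBranch m seen c′) (accepted singles n (shape c′))
  count-new {m} R st = HasCount-∷ m (IH (suc m) _ (Reachable-new R st))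

  -- a label read as a singleton is dead afterwards, one read as a new block must recur
  singleton∩new : ∀ {m seen c c′} → Reachable m (state seen c) →
    Step singles (state seen c) m (state (m L.∷ seen) c′) →
    MustRecur c′ m → ∀ v → SingletonBranch m seen c v → NewBranch m seen c′ v → ⊥
  singleton∩new {m} R st must (_ ∷ v) (singles≡true , refl , _ , run-singleton) (_ , _ , run-new) =
    Run⇒dead-absent {v = toList v} (Inv-step (inv R) (singleton-step R singles≡true)) run-singleton (here refl)
                    (λ l → ℕP.<-irrefl refl (Live⇒< R l))
                    (Run⇒pending-occurs {v = toList v} (Inv-step (inv R) st) run-new must)

  count-idle : ∀ {m seen} → Reachable m (state seen none) →
    HasCount (AcceptedFrom singles m (state seen none) {suc n}) (accepted singles (suc n) idle)
  count-idle {m} {seen} R =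
    HasCount-⇔ from to (HasCount-⊎ (count-singleton R) (count-new R st) (singleton∩new R st (inj₁ (refl , refl))))
    where
    st = first (m∉seen R)
    to : ∀ v → AcceptedFrom singles m (state seen none) v →
      SingletonBranch m seen none v ⊎ NewBranch m seen (tracking m L.[] L.[] true) v
    to (x ∷ v) ((x≤m , rgs) , _ , singleton x∉ , run) with new-label≡ R x≤m x∉
    ... | refl = inj₁ (refl , refl , subst id RGS-new rgs , run)
    to (x ∷ v) ((x≤m , rgs) , _ , first x∉ , run) with new-label≡ R x≤m x∉
    ... | refl = inj₂ (refl , subst id RGS-new rgs , run)
    from : ∀ v → SingletonBranch m seen none v ⊎ NewBranch m seen (tracking m L.[] L.[] true) v →
      AcceptedFrom singles m (state seen none) v
    from (x ∷ v) (inj₁ (singles≡true , refl , rgs , run)) =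
      (ℕP.≤-refl , subst id (sym RGS-new) rgs) , _ , singleton-step R singles≡true , run
    from (x ∷ v) (inj₂ (refl , rgs , run)) = (ℕP.≤-refl , subst id (sym RGS-new) rgs) , _ , st , run

  AgainBranch : ℕ → List ℕ → ℕ → List ℕ → List ℕ → Vec ℕ (suc n) → Set
  AgainBranch m seen x₁ P Q v = P ≡ L.[] × StartsWith x₁ (AcceptedFrom singles m (state seen (tracking x₁ Q L.[] false))) v

  NextBranch : ℕ → List ℕ → Bool → List ℕ → Vec ℕ (suc n) → Set
  NextBranch m seen false (y L.∷ R) = StartsWith y (AcceptedFrom singles m (state seen (tracking y R L.[] false)))
  NextBranch m seen false L.[]      = λ _ → ⊥
  NextBranch m seen true  L         = λ _ → ⊥

  count-again : ∀ {m seen x₁ P Q s} → Reachable m (state seen (tracking x₁ P Q s)) →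
    HasCount (AgainBranch m seen x₁ P Q) (repeatCurrent (accepted singles n) (length P) (length Q))
  count-again {m} {x₁ = x₁} {P = L.[]}    R =
    HasCount-⇔ (λ _ b → refl , b) (λ _ → proj₂) (HasCount-∷ x₁ (IH m _ (Reachable-old {singles = singles} R again)))
  count-again {P = _ L.∷ _} R = HasCount-empty (λ _ → λ ())

  count-next : ∀ {m seen x₁ P Q s} → Reachable m (state seen (tracking x₁ P Q s)) → ∀ L → P ++ Q ≡ L →
    HasCount (NextBranch m seen s L) (advance (accepted singles n) (length L) s)
  count-next {m} {s = false} R (y L.∷ R′) PQ≡ = HasCount-∷ y (IH m _ (Reachable-old {singles = singles} R (next PQ≡)))
  count-next {s = false} R L.[]        _ = HasCount-empty (λ _ ())
  count-next {s = true}  R L.[]        _ = HasCount-empty (λ _ ())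
  count-next {s = true}  R (_ L.∷ _)  _ = HasCount-empty (λ _ ())

  NextBranch-label : ∀ {m seen} s L x (v : Vec ℕ n) → NextBranch m seen s L (x ∷ v) → x ∈ L
  NextBranch-label false (y L.∷ R) x v (refl , _) = here refl

  module Tracking {m seen x₁ P Q s} (R : Reachable m (state seen (tracking x₁ P Q s))) where

    σ : State
    σ = state seen (tracking x₁ P Q s)

    c′ : Core
    c′ = tracking x₁ P (Q ++ [ m ]) s

    st : Step singles σ m (state (m L.∷ seen) c′)
    st = fresh (m∉seen R)

    x₁<m : x₁ ℕ.< m
    x₁<m = Live⇒< R (inj₁ refl)

    Branches : Vec ℕ (suc n) → Set
    Branches v =
      SingletonBranch m seen (tracking x₁ P Q s) v
      ⊎ ((NewBranch m seen c′ v ⊎ AgainBranch m seen x₁ P Q v) ⊎ NextBranch m seen s (P ++ Q) v)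

    fresh∩again : ∀ v → NewBranch m seen c′ v → AgainBranch m seen x₁ P Q v → ⊥
    fresh∩again (_ ∷ _) (refl , _) (_ , m≡x₁ , _) = ℕP.<-irrefl (sym m≡x₁) x₁<m

    fresh-or-again∩next : ∀ v → NewBranch m seen c′ v ⊎ AgainBranch m seen x₁ P Q v →
      NextBranch m seen s (P ++ Q) v → ⊥
    fresh-or-again∩next (x ∷ v) (inj₁ (refl , _)) b = ℕP.<-irrefl refl (Live⇒< R (inj₂ (NextBranch-label s (P ++ Q) x v b)))
    fresh-or-again∩next (x ∷ v) (inj₂ (_ , refl , _)) b =
      pending≢current (core-inv (inv R)) (NextBranch-label s (P ++ Q) x v b) refl

    singleton∩rest : ∀ v → SingletonBranch m seen (tracking x₁ P Q s) v →
      (NewBranch m seen c′ v ⊎ AgainBranch m seen x₁ P Q v) ⊎ NextBranch m seen s (P ++ Q) v → ⊥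
    singleton∩rest v b (inj₁ (inj₁ b′)) = singleton∩new R st (inj₂ (∈-++⁺ʳ P (∈-++⁺ʳ Q (here refl)))) v b b′
    singleton∩rest (_ ∷ _) (_ , refl , _) (inj₁ (inj₂ (_ , m≡x₁ , _))) = ℕP.<-irrefl (sym m≡x₁) x₁<m
    singleton∩rest (x ∷ v) (_ , refl , _) (inj₂ b) = ℕP.<-irrefl refl (Live⇒< R (inj₂ (NextBranch-label s (P ++ Q) x v b)))

    count-branches : HasCount Branches (accepted singles (suc n) (shape (tracking x₁ P Q s)))
    count-branches =
      HasCount-⊎ (count-singleton R)
                 (HasCount-⊎ (HasCount-⊎ count-fresh (count-again R) fresh∩again) count-next′ fresh-or-again∩next)
                 singleton∩rest
      where
      count-fresh : HasCount (NewBranch m seen c′) (accepted singles n (active (length P) (suc (length Q)) s))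
      count-fresh = subst (λ q → HasCount (NewBranch m seen c′) (accepted singles n (active (length P) q s)))
                          (trans (LP.length-++ Q) (ℕP.+-comm (length Q) 1)) (count-new R st)
      count-next′ : HasCount (NextBranch m seen s (P ++ Q)) (advance (accepted singles n) (length P ℕ.+ length Q) s)
      count-next′ = subst (HasCount (NextBranch m seen s (P ++ Q))) (cong (λ t → advance (accepted singles n) t s) (LP.length-++ P))
                          (count-next R (P ++ Q) refl)

    accepted⇒branch : ∀ v → AcceptedFrom singles m σ v → Branches v
    accepted⇒branch (x ∷ v) ((x≤m , rgs) , _ , singleton x∉ , run) with new-label≡ R x≤m x∉
    ... | refl = inj₁ (refl , refl , subst id RGS-new rgs , run)
    accepted⇒branch (x ∷ v) ((x≤m , rgs) , _ , fresh x∉ , run) with new-label≡ R x≤m x∉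
    ... | refl = inj₂ (inj₁ (inj₁ (refl , subst id RGS-new rgs , run)))
    accepted⇒branch (x ∷ v) ((x≤m , rgs) , _ , again , run) =
      inj₂ (inj₁ (inj₂ (refl , refl , subst id (RGS-old x₁<m) rgs , run)))
    accepted⇒branch (x ∷ v) ((x≤m , rgs) , _ , next PQ≡ , run) =
      inj₂ (inj₂ (subst (λ L → NextBranch m seen false L (x ∷ v)) (sym PQ≡) (refl , subst id (RGS-old x<m) rgs , run)))
      where
      x<m = Live⇒< R (inj₂ (subst (x ∈_) (sym PQ≡) (here refl)))

    next⇒accepted : ∀ s′ L → P ++ Q ≡ L → s ≡ s′ → ∀ v → NextBranch m seen s′ L v → AcceptedFrom singles m σ v
    next⇒accepted false (y L.∷ R′) PQ≡ refl (x ∷ v) (refl , rgs , run) =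
      (ℕP.<⇒≤ y<m , subst id (sym (RGS-old y<m)) rgs) , _ , next PQ≡ , run
      where
      y<m = Live⇒< R (inj₂ (subst (y ∈_) (sym PQ≡) (here refl)))

    branch⇒accepted : ∀ v → Branches v → AcceptedFrom singles m σ v
    branch⇒accepted (x ∷ v) (inj₁ (singles≡true , refl , rgs , run)) =
      (ℕP.≤-refl , subst id (sym RGS-new) rgs) , _ , singleton-step R singles≡true , run
    branch⇒accepted (x ∷ v) (inj₂ (inj₁ (inj₁ (refl , rgs , run)))) = (ℕP.≤-refl , subst id (sym RGS-new) rgs) , _ , st , run
    branch⇒accepted (x ∷ v) (inj₂ (inj₁ (inj₂ (refl , refl , rgs , run)))) =
      (ℕP.<⇒≤ x₁<m , subst id (sym (RGS-old x₁<m)) rgs) , _ , again , run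
    branch⇒accepted v (inj₂ (inj₂ b)) = next⇒accepted s (P ++ Q) refl refl v b

    count-tracking : HasCount (AcceptedFrom singles m σ {suc n}) (accepted singles (suc n) (shape (tracking x₁ P Q s)))
    count-tracking = HasCount-⇔ branch⇒accepted accepted⇒branch count-branches

count : ∀ singles n m σ → Reachable m σ →
  HasCount (AcceptedFrom singles m σ {n}) (accepted singles n (shape (core σ)))
count singles zero    m σ                               R = count-zero singles m σ
count singles (suc n) m (state seen none)               R = CountStep.count-idle singles n (count singles n) R
count singles (suc n) m (state seen (tracking _ _ _ _)) R = CountStep.Tracking.count-tracking singles n (count singles n) R

-- Generating functions of the shape counts

accepted-settled : ∀ n p q →
  accepted false n (active (suc p) q false) ≡ accepted false n (active (suc (p ℕ.+ q)) 0 false)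
accepted-settled zero    p q = refl
accepted-settled (suc n) p q =
  cong₂ ℕ._+_ (cong (ℕ._+ 0) next-pending) (cong (λ t → accepted false n (active t 0 false)) (sym (ℕP.+-identityʳ (p ℕ.+ q))))
  where
  next-pending : accepted false n (active (suc p) (suc q) false) ≡ accepted false n (active (suc (p ℕ.+ q)) 1 false)
  next-pending = begin
    accepted false n (active (suc p) (suc q) false)          ≡⟨ accepted-settled n p (suc q) ⟩
    accepted false n (active (suc (p ℕ.+ suc q)) 0 false)
      ≡⟨ cong (λ t → accepted false n (active (suc t) 0 false)) (trans (ℕP.+-suc p q) (ℕP.+-comm 1 (p ℕ.+ q))) ⟩
    accepted false n (active (suc (p ℕ.+ q ℕ.+ 1)) 0 false)  ≡⟨ accepted-settled n (p ℕ.+ q) 1 ⟨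
    accepted false n (active (suc (p ℕ.+ q)) 1 false)        ∎

shapeSeries : Shape → Series
shapeSeries sh n = + accepted false n sh

W T E : ℕ → Series
W r = shapeSeries (active r 0 false)
T q = shapeSeries (active 0 q true)
E q = shapeSeries (active 0 q false)

H : Series
H = W 0

pos-split : ∀ {m} a b → m ≡ a ℕ.+ b → + m ≡ + a ℤ.+ + b
pos-split a b refl = ℤP.pos-+ a b

W-passage : ∀ r → W (suc r) ≈ Z ⊛ (W r ⊕ W (suc (suc r)))
W-passage r = ≈Z⊛ {g = W r ⊕ W (suc (suc r))} refl (λ n → pos-split (accepted false n (active r 0 false)) _ (begin
  accepted false n (active (suc r) 1 false) ℕ.+ 0 ℕ.+ accepted false n (active (r ℕ.+ 0) 0 false)
    ≡⟨ cong₂ (λ a b → a ℕ.+ 0 ℕ.+ b) (settled-one n)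
             (cong (λ t → accepted false n (active t 0 false)) (ℕP.+-identityʳ r)) ⟩
  accepted false n (active (suc (suc r)) 0 false) ℕ.+ 0 ℕ.+ accepted false n (active r 0 false)
    ≡⟨ swap (accepted false n (active (suc (suc r)) 0 false)) (accepted false n (active r 0 false)) ⟩
  accepted false n (active r 0 false) ℕ.+ accepted false n (active (suc (suc r)) 0 false) ∎))
  where
  settled-one : ∀ n → accepted false n (active (suc r) 1 false) ≡ accepted false n (active (suc (suc r)) 0 false)
  settled-one n = trans (accepted-settled n r 1) (cong (λ t → accepted false n (active (suc t) 0 false)) (ℕP.+-comm r 1))
  swap : ∀ a b → a ℕ.+ 0 ℕ.+ b ≡ b ℕ.+ a
  swap = solve-∀

T-unroll : ∀ q → T q ≈ Z ⊛ (W q ⊕ T (suc q))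
T-unroll q = ≈Z⊛ {g = W q ⊕ T (suc q)} (cong +_ (vanish q)) (λ n → pos-split (accepted false n (active q 0 false)) _ (begin
  accepted false n (active 0 (suc q) true) ℕ.+ accepted false n (active q 0 false) ℕ.+ advance (accepted false n) q true
    ≡⟨ cong (accepted false n (active 0 (suc q) true) ℕ.+ accepted false n (active q 0 false) ℕ.+_) (no-advance n q) ⟩
  accepted false n (active 0 (suc q) true) ℕ.+ accepted false n (active q 0 false) ℕ.+ 0
    ≡⟨ swap (accepted false n (active 0 (suc q) true)) (accepted false n (active q 0 false)) ⟩
  accepted false n (active q 0 false) ℕ.+ accepted false n (active 0 (suc q) true) ∎))
  where
  vanish : ∀ q → accepting (active 0 q true) ≡ 0
  vanish zero    = refl
  vanish (suc q) = refl
  no-advance : ∀ n q → advance (accepted false n) q true ≡ 0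
  no-advance n zero    = refl
  no-advance n (suc q) = refl
  swap : ∀ a b → a ℕ.+ b ℕ.+ 0 ≡ b ℕ.+ a
  swap = solve-∀

pos-+-reverse : ∀ a b c → + (a ℕ.+ b ℕ.+ c) ≡ + c ℤ.+ + b ℤ.+ + a
pos-+-reverse a b c = begin
  + (a ℕ.+ b ℕ.+ c)        ≡⟨ cong +_ (reverse-sum a b c) ⟩
  + (c ℕ.+ b ℕ.+ a)        ≡⟨ ℤP.pos-+ (c ℕ.+ b) a ⟩
  + (c ℕ.+ b) ℤ.+ + a      ≡⟨ cong (ℤ._+ + a) (ℤP.pos-+ c b) ⟩
  + c ℤ.+ + b ℤ.+ + a      ∎
  where
  reverse-sum : ∀ a b c → a ℕ.+ b ℕ.+ c ≡ c ℕ.+ b ℕ.+ a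
  reverse-sum = solve-∀

E-unroll : ∀ q → E (suc q) ≈ Z ⊛ ((W q ⊕ W (suc q)) ⊕ E (suc (suc q)))
E-unroll q = ≈Z⊛ {g = (W q ⊕ W (suc q)) ⊕ E (suc (suc q))} refl (λ n →
  pos-+-reverse (accepted false n (active 0 (suc (suc q)) false)) _ _)

H-unroll : H ≈ const (+ 1) ⊕ Z ⊛ (E 1 ⊕ H)
H-unroll zero    = refl
H-unroll (suc n) = begin
  + (accepted false n (active 0 1 false) ℕ.+ accepted false n (active 0 0 false) ℕ.+ 0)
    ≡⟨ pos-split (accepted false n (active 0 1 false)) _ (ℕP.+-identityʳ _) ⟩
  (E 1 ⊕ H) n                                ≡⟨ Z⊛-suc (E 1 ⊕ H) n ⟨
  (Z ⊛ (E 1 ⊕ H)) (suc n)                    ≡⟨ ℤP.+-identityˡ _ ⟨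
  (const (+ 1) ⊕ Z ⊛ (E 1 ⊕ H)) (suc n)      ∎

firstPassage : ℕ → ℕ → ℕ
firstPassage zero    zero    = 1
firstPassage zero    (suc r) = 0
firstPassage (suc n) zero    = 0
firstPassage (suc n) (suc r) = firstPassage n r ℕ.+ firstPassage n (suc (suc r))

F : ℕ → Series
F r n = + firstPassage n r

B : Series
B = F 1

IsPassageFamily : (ℕ → Series) → Set
IsPassageFamily X = ∀ r → X (suc r) ≈ Z ⊛ (X r ⊕ X (suc (suc r)))

F-passage : IsPassageFamily F
F-passage r = ≈Z⊛ {g = F r ⊕ F (suc (suc r))} refl (λ n → ℤP.pos-+ (firstPassage n r) _)

F0≈1 : F 0 ≈ const (+ 1)
F0≈1 zero    = refl
F0≈1 (suc n) = refl

passage-unique : ∀ {X Y : ℕ → Series} → IsPassageFamily X → IsPassageFamily Y → X 0 ≈ Y 0 → ∀ r → X r ≈ Y r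
passage-unique {X} {Y} X-passage Y-passage X0≈Y0 r n = coefficient n r
  where
  coefficient : ∀ n r → X r n ≡ Y r n
  coefficient n       zero    = X0≈Y0 n
  coefficient zero    (suc r) = trans (X-passage r 0) (sym (Y-passage r 0))
  coefficient (suc n) (suc r) = begin
    X (suc r) (suc n)                      ≡⟨ trans (X-passage r (suc n)) (Z⊛-suc (X r ⊕ X (suc (suc r))) n) ⟩
    X r n ℤ.+ X (suc (suc r)) n            ≡⟨ cong₂ ℤ._+_ (coefficient n r) (coefficient n (suc (suc r))) ⟩
    Y r n ℤ.+ Y (suc (suc r)) n            ≡⟨ trans (Y-passage r (suc n)) (Z⊛-suc (Y r ⊕ Y (suc (suc r))) n) ⟨
    Y (suc r) (suc n)                      ∎

unroll-unique : ∀ {X Y : ℕ → Series} (R : ℕ → Series) →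
  (∀ q → X q ≈ Z ⊛ (R q ⊕ X (suc q))) → (∀ q → Y q ≈ Z ⊛ (R q ⊕ Y (suc q))) → ∀ q → X q ≈ Y q
unroll-unique {X} {Y} R X-unroll Y-unroll q n = coefficient n q
  where
  coefficient : ∀ n q → X q n ≡ Y q n
  coefficient zero    q = trans (X-unroll q 0) (sym (Y-unroll q 0))
  coefficient (suc n) q = begin
    X q (suc n)                            ≡⟨ trans (X-unroll q (suc n)) (Z⊛-suc (R q ⊕ X (suc q)) n) ⟩
    R q n ℤ.+ X (suc q) n                  ≡⟨ cong (λ t → R q n ℤ.+ t) (coefficient n (suc q)) ⟩
    R q n ℤ.+ Y (suc q) n                  ≡⟨ trans (Y-unroll q (suc n)) (Z⊛-suc (R q ⊕ Y (suc q)) n) ⟨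
    Y q (suc n)                            ∎

open SeriesSolver using (solve; _:=_; _:+_; _:*_; _:-_; con)

passage-scale : ∀ A {X} → IsPassageFamily X → IsPassageFamily (λ r → A ⊛ X r)
passage-scale A {X} X-passage r =
  ≈-trans (⊛-cong {f = A} ≈-refl (X-passage r)) (pull-out-Z A Z (X r) (X (suc (suc r))))
  where
  pull-out-Z : ∀ a z x y → a ⊛ (z ⊛ (x ⊕ y)) ≈ z ⊛ (a ⊛ x ⊕ a ⊛ y)
  pull-out-Z = solve 4 (λ a z x y → a :* (z :* (x :+ y)) := z :* (a :* x :+ a :* y)) ≈-refl

passage-pairs : ∀ {X} → IsPassageFamily X →
  ∀ q → X (suc q) ⊕ X (suc (suc q)) ≈ Z ⊛ ((X q ⊕ X (suc q)) ⊕ (X (suc (suc q)) ⊕ X (suc (suc (suc q)))))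
passage-pairs {X} X-passage q =
  ≈-trans (⊕-cong (X-passage q) (X-passage (suc q))) (regroup Z (X q) (X (suc q)) (X (suc (suc q))) (X (suc (suc (suc q)))))
  where
  regroup : ∀ z a b c d → z ⊛ (a ⊕ c) ⊕ z ⊛ (b ⊕ d) ≈ z ⊛ ((a ⊕ b) ⊕ (c ⊕ d))
  regroup = solve 5 (λ z a b c d → z :* (a :+ c) :+ z :* (b :+ d) := z :* ((a :+ b) :+ (c :+ d))) ≈-refl

F-suc : ∀ r → F (suc r) ≈ B ⊛ F r
F-suc = passage-unique (λ r → F-passage (suc r)) (passage-scale B {F} F-passage)
                       (≈-sym (≈-trans (⊛-cong {f = B} ≈-refl F0≈1) (⊛-identityʳ B)))

W≈H⊛F : ∀ r → W r ≈ H ⊛ F r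
W≈H⊛F = passage-unique W-passage (passage-scale H {F} F-passage)
                       (≈-sym (≈-trans (⊛-cong {f = H} ≈-refl F0≈1) (⊛-identityʳ H)))

T≈H⊛F : ∀ q → T q ≈ H ⊛ F (suc q)
T≈H⊛F = unroll-unique W T-unroll H⊛F-unroll
  where
  H⊛F-unroll : ∀ q → H ⊛ F (suc q) ≈ Z ⊛ (W q ⊕ H ⊛ F (suc (suc q)))
  H⊛F-unroll q = ≈-trans (passage-scale H {F} F-passage q)
                         (⊛-cong {f = Z} ≈-refl (⊕-cong {g = H ⊛ F (suc (suc q))} (≈-sym (W≈H⊛F q)) ≈-refl))

E≈H⊛F : ∀ q → E (suc q) ≈ H ⊛ F (suc q) ⊕ H ⊛ F (suc (suc q))
E≈H⊛F = unroll-unique (λ q → W q ⊕ W (suc q)) E-unroll H⊛F-pairs-unroll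
  where
  H⊛F-pairs-unroll : ∀ q → H ⊛ F (suc q) ⊕ H ⊛ F (suc (suc q))
    ≈ Z ⊛ ((W q ⊕ W (suc q)) ⊕ (H ⊛ F (suc (suc q)) ⊕ H ⊛ F (suc (suc (suc q)))))
  H⊛F-pairs-unroll q =
    ≈-trans (passage-pairs {λ r → H ⊛ F r} (passage-scale H {F} F-passage) q)
            (⊛-cong {f = Z} ≈-refl (⊕-cong {g = H ⊛ F (suc (suc q)) ⊕ H ⊛ F (suc (suc (suc q)))}
                                           (⊕-cong (≈-sym (W≈H⊛F q)) (≈-sym (W≈H⊛F (suc q)))) ≈-refl))

IsCatalan : Series → Set
IsCatalan b = b ≈ Z ⊛ (const (+ 1) ⊕ b ⊛ b)

B-catalan : IsCatalan B
B-catalan = ≈-trans (F-passage 0) (⊛-cong {f = Z} ≈-refl (⊕-cong F0≈1 F2≈B⊛B))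
  where
  F2≈B⊛B : F 2 ≈ B ⊛ B
  F2≈B⊛B = F-suc 1

H-equation : H ≈ const (+ 1) ⊕ Z ⊛ (H ⊛ (B ⊕ B ⊛ B) ⊕ H)
H-equation = ≈-trans H-unroll (⊕-cong {f = const (+ 1)} ≈-refl (⊛-cong {f = Z} ≈-refl (⊕-cong {g = H} E1 ≈-refl)))
  where
  E1 : E 1 ≈ H ⊛ (B ⊕ B ⊛ B)
  E1 = ≈-trans (E≈H⊛F 0) (≈-trans (⊕-cong {f = H ⊛ B} ≈-refl (⊛-cong {f = H} ≈-refl (F-suc 1)))
                                  (≈-sym (⊛-distribˡ-⊕ H B (B ⊛ B))))

⊖-≈0 : ∀ {a c : Series} → a ≈ c → a ⊖ c ≈ const (+ 0)
⊖-≈0 {a} {c} a≈c zero    = trans (cong (ℤ._+ - c 0) (a≈c 0)) (ℤP.+-inverseʳ (c 0))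
⊖-≈0 {a} {c} a≈c (suc n) = trans (cong (ℤ._+ - c (suc n)) (a≈c (suc n))) (ℤP.+-inverseʳ (c (suc n)))

⊕-multiple-of-0 : ∀ x c {d} → d ≈ const (+ 0) → x ⊕ c ⊛ d ≈ x
⊕-multiple-of-0 x c d≈0 =
  ≈-trans (⊕-cong {f = x} ≈-refl (⊛-cong {f = c} ≈-refl d≈0)) (annihilate x c)
  where
  annihilate : ∀ x c → x ⊕ c ⊛ const (+ 0) ≈ x
  annihilate = solve 2 (λ x c → x :+ c :* con (+ 0) := x) ≈-refl

radicandRoot : Series → Series
radicandRoot b = const (+ 1) ⊖ const (+ 2) ⊛ (Z ⊛ b)

radicandRoot-square : ∀ {b} → IsCatalan b → radicandRoot b ⊛ radicandRoot b ≈ radicand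
radicandRoot-square {b} catalan =
  ≈-trans (expand Z b) (⊕-multiple-of-0 radicand (const (- (+ 4)) ⊛ Z) (⊖-≈0 catalan))
  where
  expand : ∀ z b → (const (+ 1) ⊖ const (+ 2) ⊛ (z ⊛ b)) ⊛ (const (+ 1) ⊖ const (+ 2) ⊛ (z ⊛ b))
    ≈ (const (+ 1) ⊖ const (+ 4) ⊛ (z ⊛ (z ⊛ const (+ 1)))) ⊕ const (- (+ 4)) ⊛ z ⊛ (b ⊖ z ⊛ (const (+ 1) ⊕ b ⊛ b))
  expand = solve 2 (λ z b →
    (con (+ 1) :- con (+ 2) :* (z :* b)) :* (con (+ 1) :- con (+ 2) :* (z :* b))
    := (con (+ 1) :- con (+ 4) :* (z :* (z :* con (+ 1)))) :+ con (- (+ 4)) :* z :* (b :- z :* (con (+ 1) :+ b :* b)))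
    ≈-refl

z⊛h⊛b-equation : ∀ {b h} → IsCatalan b → h ≈ const (+ 1) ⊕ Z ⊛ (h ⊛ (b ⊕ b ⊛ b) ⊕ h) →
  Z ⊛ (h ⊛ b) ⊛ denPoly ≈ numPoly ⊖ Z ⊛ radicandRoot b
z⊛h⊛b-equation {b} {h} catalan h-equation =
  ≈-trans (certificate Z b h)
          (≈-trans (⊕-cong (⊕-multiple-of-0 (N Z b) (h ⊛ (const (- (+ 2)) ⊛ Z ⊛ (one ⊕ Z) ⊖ N Z b)) (⊖-≈0 catalan))
                           ≈-refl)
                   (⊕-multiple-of-0 (N Z b) (N Z b) (⊖-≈0 h-equation)))
  where
  one : Series
  one = const (+ 1)
  N : Series → Series → Series
  N z b = (z ⊖ const (+ 2) ⊛ (z ⊛ (z ⊛ one)) ⊛ (one ⊕ z)) ⊖ z ⊛ (one ⊖ const (+ 2) ⊛ (z ⊛ b))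
  -- the difference of the two sides as a combination of the vanishing b − z(1 + b²) and h − (1 + z(h(b + b²) + h))
  certificate : ∀ z b h →
    z ⊛ (h ⊛ b) ⊛ (const (- (+ 2)) ⊕ const (+ 2) ⊛ z ⊛ ((one ⊕ z) ⊛ ((one ⊕ z) ⊛ one)))
    ≈ N z b ⊕ h ⊛ (const (- (+ 2)) ⊛ z ⊛ (one ⊕ z) ⊖ N z b) ⊛ (b ⊖ z ⊛ (one ⊕ b ⊛ b))
            ⊕ N z b ⊛ (h ⊖ (one ⊕ z ⊛ (h ⊛ (b ⊕ b ⊛ b) ⊕ h)))
  certificate = solve 3 (λ z b h →
    let one = con (+ 1)
        N = (z :- con (+ 2) :* (z :* (z :* one)) :* (one :+ z)) :- z :* (one :- con (+ 2) :* (z :* b))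
    in z :* (h :* b) :* (con (- (+ 2)) :+ con (+ 2) :* z :* ((one :+ z) :* ((one :+ z) :* one)))
       := N :+ h :* (con (- (+ 2)) :* z :* (one :+ z) :- N) :* (b :- z :* (one :+ b :* b))
            :+ N :* (h :- (one :+ z :* (h :* (b :+ b :* b) :+ h)))) ≈-refl

IsLinear : ((Shape → ℕ) → ℕ) → Set
IsLinear Φ = ∀ n (c : ℕ → ℤ) (F : ℕ → Shape → ℕ) (f : Shape → ℕ) →
  (∀ sh → + f sh ≡ sumTo n (λ k → c k ℤ.* + F k sh)) → + Φ f ≡ sumTo n (λ k → c k ℤ.* + Φ (F k))

evaluation-linear : ∀ t → IsLinear (λ f → f t)
evaluation-linear t n c F f f≡ΣF = f≡ΣF t

zero-linear : IsLinear (λ _ → 0)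
zero-linear n c F f _ = sym (sumTo-zero n (λ k _ → ℤP.*-zeroʳ (c k)))

+-linear : ∀ {Φ Ψ} → IsLinear Φ → IsLinear Ψ → IsLinear (λ f → Φ f ℕ.+ Ψ f)
+-linear {Φ} {Ψ} Φ-linear Ψ-linear n c F f f≡ΣF = begin
  + (Φ f ℕ.+ Ψ f)                                                    ≡⟨ ℤP.pos-+ (Φ f) (Ψ f) ⟩
  + Φ f ℤ.+ + Ψ f
    ≡⟨ cong₂ ℤ._+_ (Φ-linear n c F f f≡ΣF) (Ψ-linear n c F f f≡ΣF) ⟩
  sumTo n (λ k → c k ℤ.* + Φ (F k)) ℤ.+ sumTo n (λ k → c k ℤ.* + Ψ (F k))    ≡⟨ sumTo-+ n _ _ ⟨
  sumTo n (λ k → c k ℤ.* + Φ (F k) ℤ.+ c k ℤ.* + Ψ (F k))            ≡⟨ sumTo-cong n (λ k _ → distrib k) ⟩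
  sumTo n (λ k → c k ℤ.* + (Φ (F k) ℕ.+ Ψ (F k)))                    ∎
  where
  distrib : ∀ k → c k ℤ.* + Φ (F k) ℤ.+ c k ℤ.* + Ψ (F k) ≡ c k ℤ.* + (Φ (F k) ℕ.+ Ψ (F k))
  distrib k = trans (sym (ℤP.*-distribˡ-+ (c k) _ _)) (cong (c k ℤ.*_) (sym (ℤP.pos-+ (Φ (F k)) _)))

successors-linear : ∀ sh → IsLinear (λ f → successors f sh)
successors-linear idle           = evaluation-linear (active 0 0 true)
successors-linear (active p q s) =
  +-linear (+-linear (evaluation-linear (active p (suc q) s)) (repeatCurrent-linear p)) (advance-linear (p ℕ.+ q) s)
  where
  repeatCurrent-linear : ∀ p → IsLinear (λ f → repeatCurrent f p q)
  repeatCurrent-linear zero    = evaluation-linear (active q 0 false)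
  repeatCurrent-linear (suc p) = zero-linear
  advance-linear : ∀ r s → IsLinear (λ f → advance f r s)
  advance-linear zero    s     = zero-linear
  advance-linear (suc r) false = evaluation-linear (active r 0 false)
  advance-linear (suc r) true  = zero-linear

binomial-sum-shift : ∀ n (a : ℕ → ℤ) →
  sumTo n (λ k → + (n C k) ℤ.* a k) ≡ a 0 ℤ.+ sumTo n (λ k → + (n C suc k) ℤ.* a (suc k))
binomial-sum-shift n a = begin
  sumTo n (λ k → + (n C k) ℤ.* a k)
    ≡⟨ ℤP.+-identityʳ _ ⟨
  sumTo n (λ k → + (n C k) ℤ.* a k) ℤ.+ + 0
    ≡⟨ cong (λ t → sumTo n (λ k → + (n C k) ℤ.* a k) ℤ.+ + t ℤ.* a (suc n)) (k>n⇒nCk≡0 (ℕP.n<1+n n)) ⟨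
  sumTo (suc n) (λ k → + (n C k) ℤ.* a k)
    ≡⟨ sumTo-suc n _ ⟩
  + 1 ℤ.* a 0 ℤ.+ sumTo n (λ k → + (n C suc k) ℤ.* a (suc k))
    ≡⟨ cong (ℤ._+ sumTo n (λ k → + (n C suc k) ℤ.* a (suc k))) (ℤP.*-identityˡ (a 0)) ⟩
  a 0 ℤ.+ sumTo n (λ k → + (n C suc k) ℤ.* a (suc k)) ∎

pascal-sum : ∀ n (a : ℕ → ℤ) →
  sumTo n (λ k → + (n C k) ℤ.* a k) ℤ.+ sumTo n (λ k → + (n C k) ℤ.* a (suc k))
  ≡ sumTo (suc n) (λ k → + (suc n C k) ℤ.* a k)
pascal-sum n a = begin
  sumTo n (λ k → + (n C k) ℤ.* a k) ℤ.+ sumTo n (λ k → + (n C k) ℤ.* a (suc k))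
    ≡⟨ cong (ℤ._+ sumTo n (λ k → + (n C k) ℤ.* a (suc k))) (binomial-sum-shift n a) ⟩
  a 0 ℤ.+ sumTo n (λ k → + (n C suc k) ℤ.* a (suc k)) ℤ.+ sumTo n (λ k → + (n C k) ℤ.* a (suc k))
    ≡⟨ ℤP.+-assoc (a 0) _ _ ⟩
  a 0 ℤ.+ (sumTo n (λ k → + (n C suc k) ℤ.* a (suc k)) ℤ.+ sumTo n (λ k → + (n C k) ℤ.* a (suc k)))
    ≡⟨ cong (λ t → a 0 ℤ.+ t) (trans (sym (sumTo-+ n _ _)) (sumTo-cong n (λ k _ → pascal k))) ⟩
  a 0 ℤ.+ sumTo n (λ k → + (suc n C suc k) ℤ.* a (suc k))
    ≡⟨ cong (ℤ._+ sumTo n (λ k → + (suc n C suc k) ℤ.* a (suc k))) (ℤP.*-identityˡ (a 0)) ⟨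
  + 1 ℤ.* a 0 ℤ.+ sumTo n (λ k → + (suc n C suc k) ℤ.* a (suc k))
    ≡⟨ sumTo-suc n (λ k → + (suc n C k) ℤ.* a k) ⟨
  sumTo (suc n) (λ k → + (suc n C k) ℤ.* a k) ∎
  where
  pascal : ∀ k → + (n C suc k) ℤ.* a (suc k) ℤ.+ + (n C k) ℤ.* a (suc k) ≡ + (suc n C suc k) ℤ.* a (suc k)
  pascal k = begin
    + (n C suc k) ℤ.* a (suc k) ℤ.+ + (n C k) ℤ.* a (suc k)    ≡⟨ ℤP.*-distribʳ-+ (a (suc k)) (+ (n C suc k)) (+ (n C k)) ⟨
    (+ (n C suc k) ℤ.+ + (n C k)) ℤ.* a (suc k)                ≡⟨ cong (ℤ._* a (suc k)) (ℤP.pos-+ (n C suc k) _) ⟨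
    + (n C suc k ℕ.+ n C k) ℤ.* a (suc k)                      ≡⟨ cong (λ t → + t ℤ.* a (suc k)) (ℕP.+-comm (n C suc k) _) ⟩
    + (n C k ℕ.+ n C suc k) ℤ.* a (suc k)
      ≡⟨ cong (λ t → + t ℤ.* a (suc k)) (nCk+nC[k+1]≡[n+1]C[k+1] n k) ⟩
    + (suc n C suc k) ℤ.* a (suc k)                            ∎

accepted-with-singletons : ∀ n sh → + accepted true n sh ≡ sumTo n (λ k → + (n C k) ℤ.* + accepted false k sh)
accepted-with-singletons zero    sh = sym (ℤP.*-identityˡ _)
accepted-with-singletons (suc n) sh = begin
  + (accepted true n sh ℕ.+ successors (accepted true n) sh)
    ≡⟨ ℤP.pos-+ (accepted true n sh) _ ⟩
  + accepted true n sh ℤ.+ + successors (accepted true n) sh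
    ≡⟨ cong₂ ℤ._+_ (accepted-with-singletons n sh)
                   (successors-linear sh n (λ k → + (n C k)) (accepted false) (accepted true n) (accepted-with-singletons n)) ⟩
  sumTo n (λ k → + (n C k) ℤ.* + accepted false k sh) ℤ.+ sumTo n (λ k → + (n C k) ℤ.* + accepted false (suc k) sh)
    ≡⟨ pascal-sum n (λ k → + accepted false k sh) ⟩
  sumTo (suc n) (λ k → + (suc n C k) ℤ.* + accepted false k sh) ∎

module _ (g : ℕ → ℕ) (g≡ : ∀ n → g n ≡ accepted false n idle) where

  idle-split : ∀ n → + accepted false n idle ≡ gfG g n ℤ.+ const (+ 1) n
  idle-split zero          = refl
  idle-split (suc zero)    = refl
  idle-split (suc (suc n)) = trans (cong +_ (sym (g≡ (suc (suc n))))) (sym (ℤP.+-identityʳ _))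

  gfG≈Z⊛T0 : gfG g ≈ Z ⊛ T 0
  gfG≈Z⊛T0 zero          = refl
  gfG≈Z⊛T0 (suc zero)    = sym (Z⊛-suc (T 0) 0)
  gfG≈Z⊛T0 (suc (suc n)) = trans (cong +_ (g≡ (suc (suc n)))) (sym (Z⊛-suc (T 0) (suc n)))

  Π-avoid-series : ∀ (a : ℕ → ℕ) → (∀ n → a n ≡ accepted true n idle) →
    gfAll a ≈ (gfG g ∘ₛ zOver1-z) ⊛ geom ⊕ geom
  Π-avoid-series a a≡ n = begin
    + a n
      ≡⟨ cong +_ (a≡ n) ⟩
    + accepted true n idle
      ≡⟨ accepted-with-singletons n idle ⟩
    sumTo n (λ k → + (n C k) ℤ.* + accepted false k idle)
      ≡⟨ sumTo-cong n (λ k _ → trans (cong (+ (n C k) ℤ.*_) (idle-split k)) (ℤP.*-distribˡ-+ (+ (n C k)) _ _)) ⟩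
    sumTo n (λ k → + (n C k) ℤ.* gfG g k ℤ.+ + (n C k) ℤ.* const (+ 1) k)
      ≡⟨ sumTo-+ n _ _ ⟩
    sumTo n (λ k → + (n C k) ℤ.* gfG g k) ℤ.+ sumTo n (λ k → + (n C k) ℤ.* const (+ 1) k)
      ≡⟨ cong₂ ℤ._+_ (trans (sumTo-cong n (λ k _ → ℤP.*-comm (+ (n C k)) _)) (sym (binomial-transform (gfG g) n)))
                     (trans (binomial-sum-shift n (const (+ 1)))
                            (cong (λ t → + 1 ℤ.+ t) (sumTo-zero n (λ k _ → ℤP.*-zeroʳ (+ (n C suc k)))))) ⟩
    ((gfG g ∘ₛ zOver1-z) ⊛ geom) n ℤ.+ + 1 ∎

  G-algebraic-equation : Σ Series (λ S → (S 0 ≡ + 1) × (S ⊛ S ≈ radicand) × (gfG g ⊛ denPoly ≈ numPoly ⊖ Z ⊛ S))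
  G-algebraic-equation =
    radicandRoot B , refl , radicandRoot-square B-catalan ,
    ≈-trans (⊛-cong {g = denPoly} (≈-trans gfG≈Z⊛T0 (⊛-cong {f = Z} ≈-refl (T≈H⊛F 0))) ≈-refl)
            (z⊛h⊛b-equation B-catalan H-equation)

count-Π-avoid : ∀ n → HasCount (Π-avoid n) (accepted true n idle)
count-Π-avoid n = HasCount-⇔ to from (count true n 0 initial Reachable-initial)
  where
  to : ∀ (v : Vec ℕ n) → AcceptedFrom true 0 initial v → Π-avoid n v
  to v (rgs , run) = rgs , proj₂ (Avoids⇔PatternFree v) (proj₁ (proj₁ (accepts⇔ true (toList v)) run))
  from : ∀ (v : Vec ℕ n) → Π-avoid n v → AcceptedFrom true 0 initial v
  from v (rgs , avoids) = rgs , proj₂ (accepts⇔ true (toList v)) (proj₁ (Avoids⇔PatternFree v) avoids) (λ ())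

count-Π*-avoid : ∀ n → HasCount (Π*-avoid n) (accepted false n idle)
count-Π*-avoid n = HasCount-⇔ to from (count false n 0 initial Reachable-initial)
  where
  to : ∀ (v : Vec ℕ n) → AcceptedFrom false 0 initial v → Π*-avoid n v
  to v (rgs , run) = let (free , twice) = proj₁ (accepts⇔ false (toList v)) run in
    (rgs , proj₂ (Avoids⇔PatternFree v) free) , Twice⇒NoSingletons v (twice refl)
  from : ∀ (v : Vec ℕ n) → Π*-avoid n v → AcceptedFrom false 0 initial v
  from v ((rgs , avoids) , no-singletons) =
    rgs , proj₂ (accepts⇔ false (toList v)) (proj₁ (Avoids⇔PatternFree v) avoids) (λ _ → NoSingletons⇒Twice v no-singletons)

theorem4p10 : (a g : ℕ → ℕ)
    → (∀ n → HasCount (Π-avoid n) (a n))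
    → (∀ n → HasCount (Π*-avoid n) (g n))
    → (gfAll a ≈ (gfG g ∘ₛ zOver1-z) ⊛ geom ⊕ geom)
      × Σ Series (λ S → (S 0 ≡ + 1) × (S ⊛ S ≈ radicand)
          × (gfG g ⊛ denPoly ≈ numPoly ⊖ Z ⊛ S))
theorem4p10 a g count-a count-g =
  Π-avoid-series g g≡ a (λ n → HasCount-unique (count-a n) (count-Π-avoid n)) , G-algebraic-equation g g≡
  where
  g≡ : ∀ n → g n ≡ accepted false n idle
  g≡ n = HasCount-unique (count-g n) (count-Π*-avoid n)
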